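{- Let $q$ be a quadratic form on $\mathbb{Q}^{n+1}$ of Witt index at least $2$ and rank at least $5$, and let $K=\ker(q)$. Let $\mathbf{x}\in\mathbb{Q}^{n+1}$ be a zero of $q$ with $\mathbf{x}\notin K$, and let $V=(\mathbb{Q}\mathbf{x})^\perp$. Then for each finite set of proper subspaces of $\mathbb{Q}^{n+1}$ none of which contains $V$, there is a zero of $q$ in $V$ which lies outside each of these subspaces.
   Context: $b(\mathbf{x},\mathbf{y})=q(\mathbf{x}+\mathbf{y})-q(\mathbf{x})-q(\mathbf{y})$; $U^\perp=\{\mathbf{v}: b(\mathbf{v},\mathbf{u})=0\ \forall\mathbf{u}\in U\}$; $\ker(q)=(\mathbb{Q}^{n+1})^\perp$; rank $=n+1-\dim\ker(q)$. Witt index: the unique $m$ with $\mathbb{Q}^{n+1}=\ker(q)\perp H_1\perp\cdots\perp H_m\perp W$, $H_i$ hyperbolic planes (2-dim with basis $\mathbf{u},\mathbf{v}$, $q(\mathbf{u})=q(\mathbf{v})=0\ne b(\mathbf{u},\mathbf{v})$) and $W$ anisotropic. -}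

module Defs where

open import Data.Nat using (ℕ; zero; suc)
open import Data.Fin using (Fin; zero; suc; _≟_)
open import Data.Rational using (ℚ; 0ℚ; _+_; _*_; _-_)
open import Data.Product using (Σ; _×_; ∃; ∃-syntax; _,_)
open import Function.Bundles using (_⇔_)
open import Relation.Binary.PropositionalEquality using (_≡_; _≢_)
open import Relation.Nullary using (¬_)

Vect : ℕ → Set
Vect m = Fin m → ℚ

_≈_ : ∀ {m} → Vect m → Vect m → Set
x ≈ y = ∀ j → x j ≡ y j

zeroV : ∀ {m} → Vect m
zeroV _ = 0ℚ

_⊕_ : ∀ {m} → Vect m → Vect m → Vect m
(x ⊕ y) j = x j + y j

_·_ : ∀ {m} → ℚ → Vect m → Vect m
(c · x) j = c * x j

∑ : ∀ {k} → (Fin k → ℚ) → ℚ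
∑ {zero}  f = 0ℚ
∑ {suc k} f = f zero + ∑ (λ i → f (suc i))

∑V : ∀ {k m} → (Fin k → Vect m) → Vect m
∑V {zero}  f = zeroV
∑V {suc k} f = f zero ⊕ ∑V (λ i → f (suc i))

-- A quadratic form on ℚ^m, given by its coefficient matrix:
-- q(x) = Σ_i Σ_j a_ij x_i x_j  (every quadratic form has this shape).
QuadForm : ℕ → Set
QuadForm m = Fin m → Fin m → ℚ

eval : ∀ {m} → QuadForm m → Vect m → ℚ
eval a x = ∑ (λ i → ∑ (λ j → a i j * (x i * x j)))

bil : ∀ {m} → QuadForm m → Vect m → Vect m → ℚ
bil a x y = (eval a (x ⊕ y) - eval a x) - eval a y

-- Subspaces of ℚ^m, given as spans of finitely many vectors
-- (every subspace of ℚ^m is of this form).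
Subspace : ℕ → Set
Subspace m = Σ ℕ (λ k → Fin k → Vect m)

span : ∀ {m k} → (Fin k → Vect m) → Subspace m
span {k = k} g = k , g

_∈S_ : ∀ {m} → Vect m → Subspace m → Set
v ∈S (k , g) = Σ (Fin k → ℚ) λ c → v ≈ ∑V (λ i → c i · g i)

Proper : ∀ {m} → Subspace m → Set
Proper U = ¬ (∀ v → v ∈S U)

line : ∀ {m} → Vect m → Subspace m
line x = span {k = 1} (λ _ → x)

Perp : ∀ {m} → QuadForm m → Subspace m → Vect m → Set
Perp a U v = ∀ u → u ∈S U → bil a v u ≡ 0ℚ

Ker : ∀ {m} → QuadForm m → Vect m → Set
Ker a v = ∀ u → bil a v u ≡ 0ℚ

LinIndep : ∀ {m k} → (Fin k → Vect m) → Set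
LinIndep {k = k} g = ∀ (c : Fin k → ℚ) → ∑V (λ i → c i · g i) ≈ zeroV → ∀ i → c i ≡ 0ℚ

DimKer : ∀ {m} → QuadForm m → ℕ → Set
DimKer {m} a d = Σ (Fin d → Vect m) λ e →
  LinIndep e × (∀ v → Ker a v ⇔ v ∈S span e)

Rank : ∀ {m} → QuadForm m → ℕ → Set
Rank {m} a r = ∃[ d ] (DimKer a d × (r Data.Nat.+ d ≡ m))

Hyperbolic : ∀ {m} → QuadForm m → Vect m → Vect m → Set
Hyperbolic a u v = (eval a u ≡ 0ℚ) × (eval a v ≡ 0ℚ) × (bil a u v ≢ 0ℚ)

Anisotropic : ∀ {m} → QuadForm m → Subspace m → Set
Anisotropic a W = ∀ w → w ∈S W → eval a w ≡ 0ℚ → w ≈ zeroV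

record WittDecomp {m : ℕ} (a : QuadForm m) (h : ℕ) : Set where
  field
    u v    : Fin h → Vect m
    hyp    : ∀ i → Hyperbolic a (u i) (v i)
    W      : Subspace m
    aniso  : Anisotropic a W
  H : Fin h → Subspace m
  H i = span {k = 2} (λ { zero → u i ; (suc _) → v i })
  field
    -- pairwise orthogonality of the summands (ker(q) is orthogonal to everything by definition)
    orthHH : ∀ i j → ¬ (i ≡ j) → ∀ x y → x ∈S H i → y ∈S H j → bil a x y ≡ 0ℚ
    orthHW : ∀ i x y → x ∈S H i → y ∈S W → bil a x y ≡ 0ℚ
    spanning : ∀ x → ∃[ k ] ∃[ hs ] ∃[ w ]
      (Ker a k × (∀ i → hs i ∈S H i) × w ∈S W × (x ≈ ((k ⊕ ∑V hs) ⊕ w)))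
    direct : ∀ k (hs : Fin h → Vect m) w →
      Ker a k → (∀ i → hs i ∈S H i) → w ∈S W → ((k ⊕ ∑V hs) ⊕ w) ≈ zeroV →
      (k ≈ zeroV) × (∀ i → hs i ≈ zeroV) × (w ≈ zeroV)

-- Witt index (the unique h admitting such a decomposition).
WittIndex : ∀ {m} → QuadForm m → ℕ → Set
WittIndex a h = WittDecomp a h

module Submission where

-- Let V = (ℚx)^⊥ = {v : b(x,v) = 0}.  The proof follows the classical
-- parametrisation of zeros of q.
--  * Witt index ≥ 2 gives two orthogonal hyperbolic planes; combining them
--    yields a hyperbolic pair z₀, y inside V (witt-pair).
--  * For every w, φ(w) = q(w)·z₀ − b(z₀,w)·w is a zero of q, lying in V when
--    w does.  As t ↦ φ(w + t v) is quadratic, a subspace containing three of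
--    its values contains φ(w) and φ(v) (φ-three, by Vandermonde).
--  * For a single U ⊉ V some w ∈ V has φ(w) ∉ U (escape): otherwise U would
--    contain y, z₀ and the complement C = V ∩ {z₀,y}^⊥, hence V.  Getting z₀
--    needs some c ∈ C with q(c) ≠ 0, which is where rank ≥ 5 enters: if q
--    vanished on C, then ker(q) would have codimension ≤ 4 (anisotropic-in-C).
--  * Many subspaces are handled at once by induction: each catches at most two
--    of the φ(w + t v), so one of 2k+1 values of t avoids all k (escape-all).

open import Defs
open import Level using (0ℓ)
open import Data.Nat as ℕ using (ℕ; zero; suc; _≤_; _<_; z≤n; s≤s)
import Data.Nat.Properties as NP
import Data.Nat.Coprimality as Coprime
import Data.Integer as ℤ
open import Data.Fin as F using (Fin; zero; suc)
import Data.Fin.Properties as FP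
open import Data.Rational as Q using (ℚ; 0ℚ; 1ℚ; _+_; _*_; _-_; -_)
import Data.Rational.Properties as QP
open import Data.Rational.Solver
open import Data.List using (List; []; _∷_; length; filter; upTo)
import Data.List.Properties as LP
open import Data.List.Relation.Unary.All as All using (All; []; _∷_)
open import Data.List.Relation.Unary.All.Properties using (all-filter)
open import Data.List.Relation.Unary.AllPairs using (_∷_)
open import Data.List.Relation.Unary.Unique.Propositional using (Unique)
import Data.List.Relation.Unary.Unique.Propositional.Properties as UniqueP
open import Data.List.Membership.Propositional using (_∈_)
open import Data.List.Membership.Propositional.Properties using (∈-filter⁻)
open import Data.List.Relation.Unary.Any using (here)
open import Data.Product using (Σ; ∃; ∃-syntax; _×_; _,_; proj₁; proj₂)
open import Data.Sum using (_⊎_; inj₁; inj₂)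
open import Data.Empty using (⊥; ⊥-elim)
open import Function using (_∘_)
open import Function.Bundles using (Equivalence)
open import Relation.Unary using (Pred; Decidable)
open import Relation.Unary.Properties using (∁?)
open import Relation.Binary.PropositionalEquality
open import Relation.Nullary using (¬_; Dec; yes; no)
open import Relation.Nullary.Decidable using (map′)
open +-*-Solver

-- A total reciprocal on ℚ (with inv 0 = 0), so that divisions need no
-- instance arguments; only its behaviour on nonzero arguments matters.
inv : ℚ → ℚ
inv p with p Q.≟ 0ℚ
... | yes _ = 0ℚ
... | no p≢0 = (Q.1/ p) {{Q.≢-nonZero p≢0}}

*-inv : ∀ p → p ≢ 0ℚ → p * inv p ≡ 1ℚ
*-inv p p≢0 with p Q.≟ 0ℚ
... | yes p≡0 = ⊥-elim (p≢0 p≡0)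
... | no p≢0′ = QP.*-inverseʳ p {{Q.≢-nonZero p≢0′}}

inv-cancel : ∀ k X Y → k ≢ 0ℚ → X ≡ k * Y → inv k * X ≡ Y
inv-cancel k X Y k≢0 X≡kY = begin
  inv k * X        ≡⟨ cong (inv k *_) X≡kY ⟩
  inv k * (k * Y)  ≡⟨ solve 3 (λ a b c → a :* (b :* c) := (b :* a) :* c) refl (inv k) k Y ⟩
  (k * inv k) * Y  ≡⟨ cong (_* Y) (*-inv k k≢0) ⟩
  1ℚ * Y           ≡⟨ QP.*-identityˡ Y ⟩
  Y                ∎ where open ≡-Reasoning

*-≢0 : ∀ p q → p ≢ 0ℚ → q ≢ 0ℚ → p * q ≢ 0ℚ
*-≢0 p q p≢0 q≢0 pq≡0 = q≢0 (begin
  q                ≡⟨ sym (inv-cancel p (p * q) q p≢0 refl) ⟩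
  inv p * (p * q)  ≡⟨ cong (inv p *_) pq≡0 ⟩
  inv p * 0ℚ       ≡⟨ QP.*-zeroʳ (inv p) ⟩
  0ℚ               ∎) where open ≡-Reasoning

-ve-≢0 : ∀ p → p ≢ 0ℚ → - p ≢ 0ℚ
-ve-≢0 p p≢0 -p≡0 = p≢0 (QP.neg-injective -p≡0)

*[1-cc⁻¹]≡0 : ∀ b c → c ≢ 0ℚ → b * (1ℚ - c * inv c) ≡ 0ℚ
*[1-cc⁻¹]≡0 b c c≢0 = begin
  b * (1ℚ - c * inv c)  ≡⟨ cong (λ t → b * (1ℚ - t)) (*-inv c c≢0) ⟩
  b * (1ℚ - 1ℚ)         ≡⟨ solve 1 (λ b → b :* (con 1ℚ :- con 1ℚ) := con 0ℚ) refl b ⟩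
  0ℚ                    ∎ where open ≡-Reasoning

∑-cong : ∀ {k} {f g : Fin k → ℚ} → (∀ i → f i ≡ g i) → ∑ f ≡ ∑ g
∑-cong {zero}  f≡g = refl
∑-cong {suc k} f≡g = cong₂ _+_ (f≡g zero) (∑-cong (λ i → f≡g (suc i)))

∑-+ : ∀ {k} (f g : Fin k → ℚ) → ∑ (λ i → f i + g i) ≡ ∑ f + ∑ g
∑-+ {zero}  f g = refl
∑-+ {suc k} f g = begin
  (f zero + g zero) + ∑ (λ i → f (suc i) + g (suc i))
    ≡⟨ cong ((f zero + g zero) +_) (∑-+ (λ i → f (suc i)) (λ i → g (suc i))) ⟩
  (f zero + g zero) + (∑ (λ i → f (suc i)) + ∑ (λ i → g (suc i)))
    ≡⟨ solve 4 (λ a b c d → (a :+ b) :+ (c :+ d) := (a :+ c) :+ (b :+ d)) refl (f zero) (g zero) _ _ ⟩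
  ∑ f + ∑ g ∎ where open ≡-Reasoning

∑-* : ∀ {k} (c : ℚ) (f : Fin k → ℚ) → ∑ (λ i → c * f i) ≡ c * ∑ f
∑-* {zero}  c f = sym (QP.*-zeroʳ c)
∑-* {suc k} c f = trans (cong (c * f zero +_) (∑-* c (λ i → f (suc i))))
                        (sym (QP.*-distribˡ-+ c _ _))

∑-0 : ∀ {k} (f : Fin k → ℚ) → (∀ i → f i ≡ 0ℚ) → ∑ f ≡ 0ℚ
∑-0 {zero}  f f≡0 = refl
∑-0 {suc k} f f≡0 = cong₂ _+_ (f≡0 zero) (∑-0 (λ i → f (suc i)) (λ i → f≡0 (suc i)))

∑-*0 : ∀ {k} (c f : Fin k → ℚ) → (∀ i → f i ≡ 0ℚ) → ∑ (λ i → c i * f i) ≡ 0ℚ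
∑-*0 c f f≡0 = ∑-0 _ (λ i → trans (cong (c i *_) (f≡0 i)) (QP.*-zeroʳ (c i)))

∑-swap : ∀ {k l} (f : Fin k → Fin l → ℚ) →
         ∑ (λ i → ∑ (λ j → f i j)) ≡ ∑ (λ j → ∑ (λ i → f i j))
∑-swap {zero}  {l} f = sym (∑-0 {l} (λ j → 0ℚ) (λ _ → refl))
∑-swap {suc k} {l} f = trans (cong (∑ (λ j → f zero j) +_) (∑-swap (λ i j → f (suc i) j)))
                             (sym (∑-+ (λ j → f zero j) (λ j → ∑ (λ i → f (suc i) j))))

∑-expand : ∀ {k} (f g h l : Fin k → ℚ) A B′ C →
  ∑ (λ j → f j + (A * g j + (B′ * h j + C * l j))) ≡ ∑ f + (A * ∑ g + (B′ * ∑ h + C * ∑ l))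
∑-expand f g h l A B′ C = begin
  ∑ (λ j → f j + (A * g j + (B′ * h j + C * l j)))
    ≡⟨ ∑-+ f (λ j → A * g j + (B′ * h j + C * l j)) ⟩
  ∑ f + ∑ (λ j → A * g j + (B′ * h j + C * l j))
    ≡⟨ cong (∑ f +_) (trans (∑-+ (λ j → A * g j) (λ j → B′ * h j + C * l j)) (cong₂ _+_ (∑-* A g)
         (trans (∑-+ (λ j → B′ * h j) (λ j → C * l j)) (cong₂ _+_ (∑-* B′ h) (∑-* C l))))) ⟩
  ∑ f + (A * ∑ g + (B′ * ∑ h + C * ∑ l)) ∎ where open ≡-Reasoning

∑-punch : ∀ {k} (i₀ : Fin (suc k)) (f : Fin (suc k) → ℚ) →
          ∑ f ≡ f i₀ + ∑ (λ r → f (F.punchIn i₀ r))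
∑-punch zero f = refl
∑-punch {suc k} (suc i) f = begin
  f zero + ∑ (λ r → f (suc r))
    ≡⟨ cong (f zero +_) (∑-punch i (λ r → f (suc r))) ⟩
  f zero + (f (suc i) + ∑ (λ r → f (suc (F.punchIn i r))))
    ≡⟨ solve 3 (λ a b c → a :+ (b :+ c) := b :+ (a :+ c)) refl (f zero) (f (suc i)) _ ⟩
  f (suc i) + (f zero + ∑ (λ r → f (suc (F.punchIn i r)))) ∎ where open ≡-Reasoning

comb : ∀ {k m} → (Fin k → ℚ) → (Fin k → Vect m) → Vect m
comb c g = ∑V (λ i → c i · g i)

∑V-coord : ∀ {k m} (f : Fin k → Vect m) j → ∑V f j ≡ ∑ (λ i → f i j)
∑V-coord {zero}  f j = refl
∑V-coord {suc k} f j = cong (f zero j +_) (∑V-coord (λ i → f (suc i)) j)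

comb-coord : ∀ {k m} (c : Fin k → ℚ) (g : Fin k → Vect m) p → comb c g p ≡ ∑ (λ i → c i * g i p)
comb-coord c g = ∑V-coord (λ i → c i · g i)

e : ∀ {m} → Fin m → Vect m
e zero    zero    = 1ℚ
e zero    (suc _) = 0ℚ
e (suc _) zero    = 0ℚ
e (suc i) (suc j) = e i j

∑-e : ∀ {m} (f : Fin m → ℚ) (j : Fin m) → ∑ (λ i → f i * e i j) ≡ f j
∑-e {suc m} f zero = begin
  f zero * 1ℚ + ∑ (λ i → f (suc i) * 0ℚ)  ≡⟨ cong (f zero * 1ℚ +_) (∑-*0 (λ i → f (suc i)) _ (λ _ → refl)) ⟩
  f zero * 1ℚ + 0ℚ                          ≡⟨ solve 1 (λ a → a :* con 1ℚ :+ con 0ℚ := a) refl (f zero) ⟩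
  f zero                                    ∎ where open ≡-Reasoning
∑-e {suc m} f (suc j) = begin
  f zero * 0ℚ + ∑ (λ i → f (suc i) * e i j)  ≡⟨ cong (_+ ∑ (λ i → f (suc i) * e i j)) (QP.*-zeroʳ (f zero)) ⟩
  0ℚ + ∑ (λ i → f (suc i) * e i j)           ≡⟨ QP.+-identityˡ _ ⟩
  ∑ (λ i → f (suc i) * e i j)                ≡⟨ ∑-e (λ i → f (suc i)) j ⟩
  f (suc j)                                   ∎ where open ≡-Reasoning

basis-decomp : ∀ {m} (v : Vect m) → v ≈ comb v e
basis-decomp v j = sym (trans (comb-coord v e j) (∑-e v j))

-- The polar form written out as a double sum,
--   B(x,y) = Σᵢ Σⱼ aᵢⱼ (xᵢ yⱼ + yᵢ xⱼ),
-- which makes bilinearity a termwise computation; it agrees with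
-- bil(x,y) = q(x+y) − q(x) − q(y) (lemma bil≡B).
∑∑ : ∀ {m} → (Fin m → Fin m → ℚ) → ℚ
∑∑ f = ∑ (λ i → ∑ (λ j → f i j))

∑∑-cong : ∀ {m} {f g : Fin m → Fin m → ℚ} → (∀ i j → f i j ≡ g i j) → ∑∑ f ≡ ∑∑ g
∑∑-cong f≡g = ∑-cong (λ i → ∑-cong (f≡g i))

∑∑-+ : ∀ {m} (f g : Fin m → Fin m → ℚ) → ∑∑ (λ i j → f i j + g i j) ≡ ∑∑ f + ∑∑ g
∑∑-+ f g = trans (∑-cong (λ i → ∑-+ (f i) (g i))) (∑-+ (λ i → ∑ (f i)) (λ i → ∑ (g i)))

∑∑-* : ∀ {m} c (f : Fin m → Fin m → ℚ) → ∑∑ (λ i j → c * f i j) ≡ c * ∑∑ f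
∑∑-* c f = trans (∑-cong (λ i → ∑-* c (f i))) (∑-* c (λ i → ∑ (f i)))

B : ∀ {m} → QuadForm m → Vect m → Vect m → ℚ
B a x y = ∑∑ (λ i j → a i j * (x i * y j + y i * x j))

module _ {m : ℕ} (a : QuadForm m) where

  eval-add : ∀ x y → eval a (x ⊕ y) ≡ (eval a x + eval a y) + B a x y
  eval-add x y = begin
    eval a (x ⊕ y)
      ≡⟨ ∑∑-cong (λ i j → solve 5 (λ A xi xj yi yj → A :* ((xi :+ yi) :* (xj :+ yj))
           := (A :* (xi :* xj) :+ A :* (yi :* yj)) :+ A :* (xi :* yj :+ yi :* xj)) refl (a i j) (x i) (x j) (y i) (y j)) ⟩
    ∑∑ (λ i j → (a i j * (x i * x j) + a i j * (y i * y j)) + a i j * (x i * y j + y i * x j))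
      ≡⟨ ∑∑-+ (λ i j → a i j * (x i * x j) + a i j * (y i * y j)) (λ i j → a i j * (x i * y j + y i * x j)) ⟩
    ∑∑ (λ i j → a i j * (x i * x j) + a i j * (y i * y j)) + B a x y
      ≡⟨ cong (_+ B a x y) (∑∑-+ (λ i j → a i j * (x i * x j)) (λ i j → a i j * (y i * y j))) ⟩
    (eval a x + eval a y) + B a x y ∎ where open ≡-Reasoning

  bil≡B : ∀ x y → bil a x y ≡ B a x y
  bil≡B x y = trans (cong (λ t → (t - eval a x) - eval a y) (eval-add x y))
    (solve 3 (λ E F G → ((E :+ F) :+ G) :- E :- F := G) refl (eval a x) (eval a y) (B a x y))

  eval-scale : ∀ s x → eval a (s · x) ≡ (s * s) * eval a x
  eval-scale s x = trans
    (∑∑-cong (λ i j → solve 4 (λ s A xi xj → A :* ((s :* xi) :* (s :* xj)) := (s :* s) :* (A :* (xi :* xj))) refl s (a i j) (x i) (x j)))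
    (∑∑-* (s * s) (λ i j → a i j * (x i * x j)))

  B-sym : ∀ x y → B a x y ≡ B a y x
  B-sym x y = ∑∑-cong (λ i j → cong (a i j *_) (QP.+-comm (x i * y j) (y i * x j)))

  B-self : ∀ x → B a x x ≡ (1ℚ + 1ℚ) * eval a x
  B-self x = trans
    (∑∑-cong (λ i j → solve 3 (λ A xi xj → A :* (xi :* xj :+ xi :* xj) := (con 1ℚ :+ con 1ℚ) :* (A :* (xi :* xj))) refl (a i j) (x i) (x j)))
    (∑∑-* (1ℚ + 1ℚ) (λ i j → a i j * (x i * x j)))

  B-iso : ∀ x → eval a x ≡ 0ℚ → B a x x ≡ 0ℚ
  B-iso x qx = trans (B-self x) (trans (cong ((1ℚ + 1ℚ) *_) qx) (QP.*-zeroʳ (1ℚ + 1ℚ)))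

  B-cong : ∀ {x x′ y y′} → x ≈ x′ → y ≈ y′ → B a x y ≡ B a x′ y′
  B-cong x≈ y≈ = ∑∑-cong (λ i j → cong (a i j *_) (cong₂ _+_ (cong₂ _*_ (x≈ i) (y≈ j)) (cong₂ _*_ (y≈ i) (x≈ j))))

  B-add : ∀ x y z → B a (x ⊕ y) z ≡ B a x z + B a y z
  B-add x y z = trans
    (∑∑-cong (λ i j → solve 7 (λ A xi xj yi yj zi zj → A :* ((xi :+ yi) :* zj :+ zi :* (xj :+ yj))
       := A :* (xi :* zj :+ zi :* xj) :+ A :* (yi :* zj :+ zi :* yj)) refl (a i j) (x i) (x j) (y i) (y j) (z i) (z j)))
    (∑∑-+ (λ i j → a i j * (x i * z j + z i * x j)) (λ i j → a i j * (y i * z j + z i * y j)))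

  B-scale : ∀ s x z → B a (s · x) z ≡ s * B a x z
  B-scale s x z = trans
    (∑∑-cong (λ i j → solve 6 (λ s A xi xj zi zj → A :* ((s :* xi) :* zj :+ zi :* (s :* xj))
       := s :* (A :* (xi :* zj :+ zi :* xj))) refl s (a i j) (x i) (x j) (z i) (z j)))
    (∑∑-* s (λ i j → a i j * (x i * z j + z i * x j)))

  B-zero : ∀ z → B a zeroV z ≡ 0ℚ
  B-zero z = trans (B-cong {x′ = 0ℚ · zeroV} {z} {z} (λ _ → sym (QP.*-zeroˡ 0ℚ)) (λ _ → refl))
                   (trans (B-scale 0ℚ zeroV z) (QP.*-zeroˡ (B a zeroV z)))

  B-lin : ∀ s x t y z → B a ((s · x) ⊕ (t · y)) z ≡ s * B a x z + t * B a y z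
  B-lin s x t y z = trans (B-add (s · x) (t · y) z) (cong₂ _+_ (B-scale s x z) (B-scale t y z))

  B-add₂ : ∀ x y z → B a z (x ⊕ y) ≡ B a z x + B a z y
  B-add₂ x y z = trans (B-sym z (x ⊕ y)) (trans (B-add x y z) (cong₂ _+_ (B-sym x z) (B-sym y z)))

  B-scale₂ : ∀ s x z → B a z (s · x) ≡ s * B a z x
  B-scale₂ s x z = trans (B-sym z (s · x)) (trans (B-scale s x z) (cong (s *_) (B-sym x z)))

  B-zero₂ : ∀ z → B a z zeroV ≡ 0ℚ
  B-zero₂ z = trans (B-sym z zeroV) (B-zero z)

  B-lin₂ : ∀ s x t y z → B a z ((s · x) ⊕ (t · y)) ≡ s * B a z x + t * B a z y
  B-lin₂ s x t y z = trans (B-add₂ (s · x) (t · y) z) (cong₂ _+_ (B-scale₂ s x z) (B-scale₂ t y z))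

  eval-comb : ∀ s x t y → eval a ((s · x) ⊕ (t · y)) ≡ ((s * s) * eval a x + (s * t) * B a x y) + (t * t) * eval a y
  eval-comb s x t y = begin
    eval a ((s · x) ⊕ (t · y))
      ≡⟨ eval-add (s · x) (t · y) ⟩
    (eval a (s · x) + eval a (t · y)) + B a (s · x) (t · y)
      ≡⟨ cong₂ _+_ (cong₂ _+_ (eval-scale s x) (eval-scale t y)) (trans (B-scale s x (t · y)) (cong (s *_) (B-scale₂ t y x))) ⟩
    ((s * s) * eval a x + (t * t) * eval a y) + s * (t * B a x y)
      ≡⟨ solve 5 (λ s t X Y Z → ((s :* s) :* X :+ (t :* t) :* Y) :+ s :* (t :* Z)
           := ((s :* s) :* X :+ (s :* t) :* Z) :+ (t :* t) :* Y) refl s t (eval a x) (eval a y) (B a x y) ⟩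
    ((s * s) * eval a x + (s * t) * B a x y) + (t * t) * eval a y ∎ where open ≡-Reasoning

  B-comb : ∀ {k} (c : Fin k → ℚ) (g : Fin k → Vect m) z → B a (comb c g) z ≡ ∑ (λ i → c i * B a (g i) z)
  B-comb {zero}  c g z = B-zero z
  B-comb {suc k} c g z = trans (B-add (c zero · g zero) (comb (λ i → c (suc i)) (λ i → g (suc i))) z)
    (cong₂ _+_ (B-scale (c zero) (g zero) z) (B-comb (λ i → c (suc i)) (λ i → g (suc i)) z))

  B-coord : ∀ v z → B a v z ≡ ∑ (λ j → v j * B a (e j) z)
  B-coord v z = trans (B-cong (basis-decomp v) (λ _ → refl)) (B-comb v e z)

  B-coord₂ : ∀ z v → B a z v ≡ ∑ (λ j → v j * B a z (e j))
  B-coord₂ z v = trans (B-sym z v) (trans (B-coord v z) (∑-cong (λ j → cong (v j *_) (B-sym (e j) z))))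

  ker-on-basis : ∀ k → (∀ j → B a k (e j) ≡ 0ℚ) → Ker a k
  ker-on-basis k k⊥e u = trans (bil≡B k u) (trans (B-coord₂ k u) (∑-*0 u _ k⊥e))

all-or-counterexample : ∀ {n} (P : Fin n → Set) → (∀ i → Dec (P i)) → (∀ i → P i) ⊎ ∃ λ i → ¬ P i
all-or-counterexample {n} P P? with FP.all? P?
... | yes all = inj₁ all
... | no ¬all = inj₂ (FP.¬∀⟶∃¬ n P P? ¬all)

module _ {m : ℕ} where

  ∈S-cong : ∀ {U : Subspace m} {v w} → v ≈ w → w ∈S U → v ∈S U
  ∈S-cong v≈w (c , w≈) = c , λ j → trans (v≈w j) (w≈ j)

  ∈S-zero : ∀ (U : Subspace m) → zeroV ∈S U
  ∈S-zero (k , g) = (λ _ → 0ℚ) , λ j → sym (trans (comb-coord (λ _ → 0ℚ) g j) (∑-0 _ (λ i → QP.*-zeroˡ (g i j))))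

  ∈S-lin : ∀ (U : Subspace m) s {v} t {w} → v ∈S U → w ∈S U → ((s · v) ⊕ (t · w)) ∈S U
  ∈S-lin (k , g) s {v} t {w} (c , v≈) (d , w≈) = (λ i → s * c i + t * d i) , λ j → begin
    s * v j + t * w j
      ≡⟨ cong₂ (λ p q → s * p + t * q) (trans (v≈ j) (comb-coord c g j)) (trans (w≈ j) (comb-coord d g j)) ⟩
    s * ∑ (λ i → c i * g i j) + t * ∑ (λ i → d i * g i j)
      ≡⟨ sym (cong₂ _+_ (∑-* s (λ i → c i * g i j)) (∑-* t (λ i → d i * g i j))) ⟩
    ∑ (λ i → s * (c i * g i j)) + ∑ (λ i → t * (d i * g i j))
      ≡⟨ sym (∑-+ (λ i → s * (c i * g i j)) (λ i → t * (d i * g i j))) ⟩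
    ∑ (λ i → s * (c i * g i j) + t * (d i * g i j))
      ≡⟨ ∑-cong (λ i → solve 5 (λ s c t d x → s :* (c :* x) :+ t :* (d :* x) := (s :* c :+ t :* d) :* x) refl s (c i) t (d i) (g i j)) ⟩
    ∑ (λ i → (s * c i + t * d i) * g i j)
      ≡⟨ sym (comb-coord (λ i → s * c i + t * d i) g j) ⟩
    comb (λ i → s * c i + t * d i) g j ∎ where open ≡-Reasoning

  ∈S-scale : ∀ (U : Subspace m) s {v} → v ∈S U → (s · v) ∈S U
  ∈S-scale U s {v} v∈ = ∈S-cong {U} (λ j → solve 2 (λ s x → s :* x := s :* x :+ con 0ℚ :* x) refl s (v j))
                                    (∈S-lin U s 0ℚ v∈ v∈)

  ∈S-add : ∀ (U : Subspace m) {v w} → v ∈S U → w ∈S U → (v ⊕ w) ∈S U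
  ∈S-add U {v} {w} v∈ w∈ = ∈S-cong {U} (λ j → solve 2 (λ x y → x :+ y := con 1ℚ :* x :+ con 1ℚ :* y) refl (v j) (w j))
                                       (∈S-lin U 1ℚ 1ℚ v∈ w∈)

  ∈S-lin₃ : ∀ (U : Subspace m) s {X} t {Y} u {Z} → X ∈S U → Y ∈S U → Z ∈S U → ((s · X) ⊕ ((t · Y) ⊕ (u · Z))) ∈S U
  ∈S-lin₃ U s {X} t {Y} u {Z} X∈ Y∈ Z∈ =
    ∈S-add U (∈S-scale U s X∈) (∈S-lin U t u Y∈ Z∈)

  ∈S-comb : ∀ (U : Subspace m) {l} (c : Fin l → ℚ) (f : Fin l → Vect m) → (∀ i → f i ∈S U) → comb c f ∈S U
  ∈S-comb U {zero}  c f f∈ = ∈S-zero U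
  ∈S-comb U {suc l} c f f∈ = ∈S-add U (∈S-scale U (c zero) (f∈ zero)) (∈S-comb U (λ i → c (suc i)) (λ i → f (suc i)) (λ i → f∈ (suc i)))

∑-affine : ∀ {k} (c A Bv : Fin k → ℚ) (s X : ℚ) →
           ∑ (λ i → c i * (A i - (Bv i * s) * X)) ≡ ∑ (λ i → c i * A i) - (∑ (λ i → c i * Bv i) * s) * X
∑-affine c A Bv s X = begin
  ∑ (λ i → c i * (A i - (Bv i * s) * X))
    ≡⟨ ∑-cong (λ i → solve 5 (λ c a b s X → c :* (a :- (b :* s) :* X) := c :* a :+ (:- (s :* X)) :* (c :* b)) refl (c i) (A i) (Bv i) s X) ⟩
  ∑ (λ i → c i * A i + (- (s * X)) * (c i * Bv i))
    ≡⟨ ∑-+ (λ i → c i * A i) (λ i → (- (s * X)) * (c i * Bv i)) ⟩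
  ∑ (λ i → c i * A i) + ∑ (λ i → (- (s * X)) * (c i * Bv i))
    ≡⟨ cong (∑ (λ i → c i * A i) +_) (∑-* (- (s * X)) (λ i → c i * Bv i)) ⟩
  ∑ (λ i → c i * A i) + (- (s * X)) * ∑ (λ i → c i * Bv i)
    ≡⟨ solve 4 (λ a b s X → a :+ (:- (s :* X)) :* b := a :- (b :* s) :* X) refl (∑ (λ i → c i * A i)) (∑ (λ i → c i * Bv i)) s X ⟩
  ∑ (λ i → c i * A i) - (∑ (λ i → c i * Bv i) * s) * X ∎ where open ≡-Reasoning

-- One step of Gaussian elimination on a family (h, g₁, …, g_k) with h j ≠ 0:
-- the map red subtracts from w the multiple of h clearing coordinate j.  It
-- is linear and kills h, so v lies in span(h, g₁, …, g_k) iff red v lies in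
-- span(red g₁, …, red g_k).
module Elimination {m k : ℕ} (hg : Fin (suc k) → Vect m) (j : Fin m) (hj≢0 : hg zero j ≢ 0ℚ) where

  h : Vect m
  h = hg zero

  g : Fin k → Vect m
  g = hg ∘ suc

  ι : ℚ
  ι = inv (h j)

  red : Vect m → Vect m
  red w p = w p - (w j * ι) * h p

  red-cong : ∀ {v w} → v ≈ w → red v ≈ red w
  red-cong v≈w p = cong₂ (λ s t → s - (t * ι) * h p) (v≈w p) (v≈w j)

  red-kills-h : ∀ c w → red ((c · h) ⊕ w) ≈ red w
  red-kills-h c w p = begin
    (c * h p + w p) - ((c * h j + w j) * ι) * h p
      ≡⟨ solve 6 (λ c hp w hj wj ι → (c :* hp :+ w) :- ((c :* hj :+ wj) :* ι) :* hp
                   := (w :- (wj :* ι) :* hp) :+ (c :* hp) :* (con 1ℚ :- hj :* ι)) refl c (h p) (w p) (h j) (w j) ι ⟩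
    red w p + (c * h p) * (1ℚ - h j * ι)
      ≡⟨ cong (red w p +_) (*[1-cc⁻¹]≡0 (c * h p) (h j) hj≢0) ⟩
    red w p + 0ℚ
      ≡⟨ QP.+-identityʳ (red w p) ⟩
    red w p ∎ where open ≡-Reasoning

  red-comb : ∀ c → red (comb c g) ≈ comb c (red ∘ g)
  red-comb c p = begin
    comb c g p - (comb c g j * ι) * h p
      ≡⟨ cong₂ (λ s t → s - (t * ι) * h p) (comb-coord c g p) (comb-coord c g j) ⟩
    ∑ (λ i → c i * g i p) - (∑ (λ i → c i * g i j) * ι) * h p
      ≡⟨ sym (∑-affine c (λ i → g i p) (λ i → g i j) ι (h p)) ⟩
    ∑ (λ i → c i * red (g i) p)
      ≡⟨ sym (comb-coord c (red ∘ g) p) ⟩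
    comb c (red ∘ g) p ∎ where open ≡-Reasoning

  sound : ∀ {v} → red v ∈S (k , red ∘ g) → v ∈S (suc k , hg)
  sound {v} (c , redv≈) = cf , λ p → begin
      v p
        ≡⟨ solve 3 (λ v s x → v := (v :- s :* x) :+ s :* x) refl (v p) (v j * ι) (h p) ⟩
      red v p + (v j * ι) * h p
        ≡⟨ cong (_+ (v j * ι) * h p) (trans (redv≈ p) (sym (red-comb c p))) ⟩
      (T p - (T j * ι) * h p) + (v j * ι) * h p
        ≡⟨ solve 5 (λ T Tj ι hp vj → (T :- (Tj :* ι) :* hp) :+ (vj :* ι) :* hp := (vj :* ι :- Tj :* ι) :* hp :+ T) refl (T p) (T j) ι (h p) (v j) ⟩
      cf zero * h p + T p ∎
    where
    open ≡-Reasoning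
    T = comb c g
    cf : Fin (suc k) → ℚ
    cf zero    = v j * ι - T j * ι
    cf (suc i) = c i

  complete : ∀ {v} → v ∈S (suc k , hg) → red v ∈S (k , red ∘ g)
  complete {v} (c , v≈) = (c ∘ suc) , λ p →
    trans (red-cong v≈ p) (trans (red-kills-h (c zero) (comb (c ∘ suc) g) p) (red-comb (c ∘ suc) p))

module _ {m : ℕ} where

  isZero? : (v : Vect m) → Dec (v ≈ zeroV)
  isZero? v = FP.all? (λ j → v j Q.≟ 0ℚ)

  dec-span : ∀ k (g : Fin k → Vect m) v → Dec (v ∈S (k , g))
  dec-span zero g v = map′ (λ v≈0 → (λ ()) , v≈0) proj₂ (isZero? v)
  dec-span (suc k) g v with all-or-counterexample (λ j → g zero j ≡ 0ℚ) (λ j → g zero j Q.≟ 0ℚ)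
  ... | inj₁ g₀≈0 = map′ add-zero drop-zero (dec-span k (g ∘ suc) v)
    where
    add-zero : v ∈S (k , g ∘ suc) → v ∈S (suc k , g)
    add-zero (c , v≈) = (λ { zero → 0ℚ ; (suc i) → c i }) , λ p →
      trans (v≈ p) (sym (trans (cong (_+ comb c (g ∘ suc) p) (QP.*-zeroˡ (g zero p))) (QP.+-identityˡ _)))
    drop-zero : v ∈S (suc k , g) → v ∈S (k , g ∘ suc)
    drop-zero (c , v≈) = (c ∘ suc) , λ p →
      trans (v≈ p) (trans (cong (λ t → c zero * t + comb (c ∘ suc) (g ∘ suc) p) (g₀≈0 p))
                          (trans (cong (_+ comb (c ∘ suc) (g ∘ suc) p) (QP.*-zeroʳ (c zero))) (QP.+-identityˡ _)))
  ... | inj₂ (j , g₀j≢0) =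
    map′ sound complete (dec-span k (red ∘ g ∘ suc) (red v))
    where open Elimination g j g₀j≢0 using (red; sound; complete)

  dec∈S : ∀ (U : Subspace m) v → Dec (v ∈S U)
  dec∈S (k , g) = dec-span k g

Nontrivial : ∀ {k} → (Fin k → ℚ) → Set
Nontrivial c = ∃ λ i → c i ≢ 0ℚ

-- Induction on l: if some Aᵢ₀ has a nonzero first coordinate, eliminate that
-- coordinate from the other k−1 vectors and solve for them recursively;
-- otherwise the first equation is void.
dependent : ∀ l k → l < k → (A : Fin k → Vect l) →
            Σ (Fin k → ℚ) λ c → Nontrivial c × (∀ s → ∑ (λ i → c i * A i s) ≡ 0ℚ)
dependent zero (suc k) _ A = (λ _ → 1ℚ) , (zero , λ ()) , λ ()
dependent (suc l) (suc k) (s≤s l<k) A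
  with all-or-counterexample (λ i → A i zero ≡ 0ℚ) (λ i → A i zero Q.≟ 0ℚ)
... | inj₁ A₀≡0 =
  let (c , nt , sol) = dependent l (suc k) (NP.m<n⇒m<1+n l<k) (λ i s → A i (suc s))
  in c , nt , λ { zero → ∑-*0 c (λ i → A i zero) A₀≡0 ; (suc s) → sol s }
... | inj₂ (i₀ , a≢0) = c , nontrivial , solves
  where
  a = A i₀ zero
  ι = inv a
  pI = F.punchIn i₀
  A′ : Fin k → Vect l
  A′ r s = A (pI r) (suc s) - (A (pI r) zero * ι) * A i₀ (suc s)
  rec = dependent l k l<k A′
  c′ = proj₁ rec
  S₀ = ∑ (λ r → c′ r * A (pI r) zero)
  μ = - (S₀ * ι)
  c : Fin (suc k) → ℚ
  c i with i F.≟ i₀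
  ... | yes _ = μ
  ... | no i≢i₀ = c′ (F.punchOut (i≢i₀ ∘ sym))
  c-i₀ : c i₀ ≡ μ
  c-i₀ with i₀ F.≟ i₀
  ... | yes _ = refl
  ... | no i₀≢i₀ = ⊥-elim (i₀≢i₀ refl)
  c-pI : ∀ r → c (pI r) ≡ c′ r
  c-pI r with pI r F.≟ i₀
  ... | yes pIr≡i₀ = ⊥-elim (FP.punchInᵢ≢i i₀ r pIr≡i₀)
  ... | no _ = cong c′ (trans (FP.punchOut-cong i₀ refl) (FP.punchOut-punchIn i₀))
  split : ∀ (X : Fin (suc k) → ℚ) → ∑ (λ i → c i * X i) ≡ μ * X i₀ + ∑ (λ r → c′ r * X (pI r))
  split X = trans (∑-punch i₀ (λ i → c i * X i))
                  (cong₂ _+_ (cong (_* X i₀) c-i₀) (∑-cong (λ r → cong (_* X (pI r)) (c-pI r))))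
  nontrivial : Nontrivial c
  nontrivial = let (r₀ , c′r₀≢0) = proj₁ (proj₂ rec) in pI r₀ , λ c≡0 → c′r₀≢0 (trans (sym (c-pI r₀)) c≡0)
  solves : ∀ s → ∑ (λ i → c i * A i s) ≡ 0ℚ
  solves zero = begin
    ∑ (λ i → c i * A i zero)  ≡⟨ split (λ i → A i zero) ⟩
    μ * a + S₀                ≡⟨ solve 3 (λ S ι a → (:- (S :* ι)) :* a :+ S := S :* (con 1ℚ :- a :* ι)) refl S₀ ι a ⟩
    S₀ * (1ℚ - a * ι)         ≡⟨ *[1-cc⁻¹]≡0 S₀ a a≢0 ⟩
    0ℚ                        ∎ where open ≡-Reasoning
  solves (suc s) = begin
    ∑ (λ i → c i * A i (suc s))  ≡⟨ split (λ i → A i (suc s)) ⟩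
    μ * X₀ + T                   ≡⟨ cong (μ * X₀ +_) T≡ ⟩
    μ * X₀ + (S₀ * ι) * X₀       ≡⟨ solve 3 (λ S ι X → (:- (S :* ι)) :* X :+ (S :* ι) :* X := con 0ℚ) refl S₀ ι X₀ ⟩
    0ℚ                           ∎
    where
    open ≡-Reasoning
    X₀ = A i₀ (suc s)
    T = ∑ (λ r → c′ r * A (pI r) (suc s))
    reduced : T - (S₀ * ι) * X₀ ≡ 0ℚ
    reduced = trans (sym (∑-affine c′ (λ r → A (pI r) (suc s)) (λ r → A (pI r) zero) ι X₀)) (proj₂ (proj₂ rec) s)
    T≡ : T ≡ (S₀ * ι) * X₀
    T≡ = begin
      T                                   ≡⟨ solve 2 (λ T Y → T := (T :- Y) :+ Y) refl T ((S₀ * ι) * X₀) ⟩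
      (T - (S₀ * ι) * X₀) + (S₀ * ι) * X₀ ≡⟨ cong (_+ (S₀ * ι) * X₀) reduced ⟩
      0ℚ + (S₀ * ι) * X₀                  ≡⟨ QP.+-identityˡ _ ⟩
      (S₀ * ι) * X₀                       ∎

-- If the l vectors G span all of ℚ^m then m ≤ l: otherwise the coordinate
-- vectors of e₀,…,e_{m-1} with respect to G would be dependent, and
-- applying a dependence to e yields a nonzero vector equal to zero.
dim-bound : ∀ {m l} (G : Fin l → Vect m) → (∀ i → e i ∈S (l , G)) → m ≤ l
dim-bound {m} {l} G e∈ with m ℕ.≤? l
... | yes m≤l = m≤l
... | no m≰l = ⊥-elim (ci₀≢0 ci₀≡0)
  where
  A : Fin m → Vect l
  A i = proj₁ (e∈ i)
  dep = dependent l m (NP.≰⇒> m≰l) A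
  c = proj₁ dep
  i₀ = proj₁ (proj₁ (proj₂ dep))
  ci₀≢0 = proj₂ (proj₁ (proj₂ dep))
  ci₀≡0 : c i₀ ≡ 0ℚ
  ci₀≡0 = begin
    c i₀                                           ≡⟨ sym (∑-e c i₀) ⟩
    ∑ (λ i → c i * e i i₀)                         ≡⟨ ∑-cong (λ i → cong (c i *_) (trans (proj₂ (e∈ i) i₀) (comb-coord (A i) G i₀))) ⟩
    ∑ (λ i → c i * ∑ (λ s → A i s * G s i₀))       ≡⟨ ∑-cong (λ i → sym (∑-* (c i) (λ s → A i s * G s i₀))) ⟩
    ∑ (λ i → ∑ (λ s → c i * (A i s * G s i₀)))     ≡⟨ ∑-swap (λ i s → c i * (A i s * G s i₀)) ⟩
    ∑ (λ s → ∑ (λ i → c i * (A i s * G s i₀)))     ≡⟨ ∑-cong (λ s → trans (∑-cong (λ i → solve 3 (λ c a g → c :* (a :* g) := g :* (c :* a)) refl (c i) (A i s) (G s i₀)))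
                                                                        (∑-* (G s i₀) (λ i → c i * A i s))) ⟩
    ∑ (λ s → G s i₀ * ∑ (λ i → c i * A i s))       ≡⟨ ∑-*0 (λ s → G s i₀) _ (proj₂ (proj₂ dep)) ⟩
    0ℚ                                             ∎ where open ≡-Reasoning

append : ∀ {k d} {A : Set} → (Fin k → A) → (Fin d → A) → Fin (k ℕ.+ d) → A
append {zero}  f g i       = g i
append {suc k} f g zero    = f zero
append {suc k} f g (suc i) = append (f ∘ suc) g i

comb-append : ∀ {k d m} (c : Fin k → ℚ) (c′ : Fin d → ℚ) (g : Fin k → Vect m) (g′ : Fin d → Vect m) →
              comb (append c c′) (append g g′) ≈ (comb c g ⊕ comb c′ g′)
comb-append {zero}  c c′ g g′ p = sym (QP.+-identityˡ _)
comb-append {suc k} c c′ g g′ p =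
  trans (cong (c zero * g zero p +_) (comb-append (c ∘ suc) c′ (g ∘ suc) g′ p))
        (sym (QP.+-assoc (c zero * g zero p) _ _))

InSpanKer : ∀ {m k} → QuadForm m → (Fin k → Vect m) → Vect m → Set
InSpanKer {m} {k} a g v = Σ (Fin k → ℚ) λ c → Σ (Vect m) λ κ → Ker a κ × (v ≈ (comb c g ⊕ κ))

rank-bound : ∀ {m k r} (a : QuadForm m) → Rank a r → (g : Fin k → Vect m) →
             (∀ i → InSpanKer a g (e i)) → r ≤ k
rank-bound {m} {k} {r} a (d , (E , _ , ker⇔span) , r+d≡m) g e∈ =
  NP.+-cancelʳ-≤ d r k (subst (_≤ k ℕ.+ d) (sym r+d≡m) (dim-bound (append g E) e∈span))
  where
  e∈span : ∀ i → e i ∈S (k ℕ.+ d , append g E)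
  e∈span i with e∈ i
  ... | c , κ , κ∈ker , e≈ with Equivalence.to (ker⇔span κ) κ∈ker
  ...   | c′ , κ≈ = append c c′ , λ p → trans (e≈ p) (trans (cong (comb c g p +_) (κ≈ p)) (sym (comb-append c c′ g E p)))

curve : ∀ {m} → Vect m → Vect m → Vect m → ℚ → Vect m
curve W P V t = W ⊕ ((t · P) ⊕ ((t * t) · V))

module _ {m : ℕ} (U : Subspace m) where

  difference∈S : ∀ k {X Y Z : Vect m} → k ≢ 0ℚ → X ∈S U → Y ∈S U → (∀ p → X p - Y p ≡ k * Z p) → Z ∈S U
  difference∈S k {X} {Y} {Z} k≢0 X∈ Y∈ X-Y≡kZ = ∈S-cong {U = U} Z≈ (∈S-lin U (inv k) (- inv k) X∈ Y∈)
    where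
    Z≈ : Z ≈ ((inv k · X) ⊕ ((- inv k) · Y))
    Z≈ p = sym (trans (solve 3 (λ i x y → i :* x :+ (:- i) :* y := i :* (x :- y)) refl (inv k) (X p) (Y p))
                      (inv-cancel k (X p - Y p) (Z p) k≢0 (X-Y≡kZ p)))

  divide∈S : ∀ k {X Z : Vect m} → k ≢ 0ℚ → X ∈S U → (∀ p → X p ≡ k * Z p) → Z ∈S U
  divide∈S k {X} k≢0 X∈ X≡kZ = difference∈S k k≢0 X∈ (∈S-zero U) (λ p → trans (QP.+-identityʳ (X p)) (X≡kZ p))

  quadratic-curve : ∀ (W P V : Vect m) (α β γ : ℚ) → α - β ≢ 0ℚ → α - γ ≢ 0ℚ → β - γ ≢ 0ℚ →
    curve W P V α ∈S U → curve W P V β ∈S U → curve W P V γ ∈S U → (W ∈S U) × (V ∈S U)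
  quadratic-curve W P V α β γ α≢β α≢γ β≢γ Rα Rβ Rγ = W∈ , V∈
    where
    -- divided differences: (R s − R t)/(s − t) = P + (s + t)V
    divided : ∀ s t → s - t ≢ 0ℚ → curve W P V s ∈S U → curve W P V t ∈S U → (P ⊕ ((s + t) · V)) ∈S U
    divided s t s≢t Rs Rt = difference∈S (s - t) s≢t Rs Rt (λ p →
      solve 5 (λ W P V s t → (W :+ (s :* P :+ (s :* s) :* V)) :- (W :+ (t :* P :+ (t :* t) :* V))
                             := (s :- t) :* (P :+ (s :+ t) :* V)) refl (W p) (P p) (V p) s t)
    Dαβ = divided α β α≢β Rα Rβ
    V∈ : V ∈S U
    V∈ = difference∈S (β - γ) β≢γ Dαβ (divided α γ α≢γ Rα Rγ) (λ p →
      solve 5 (λ P V a b c → (P :+ (a :+ b) :* V) :- (P :+ (a :+ c) :* V) := (b :- c) :* V) refl (P p) (V p) α β γ)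
    P∈ : P ∈S U
    P∈ = ∈S-cong {U = U} (λ p → solve 3 (λ P V s → P := con 1ℚ :* (P :+ s :* V) :+ (:- s) :* V) refl (P p) (V p) (α + β))
                        (∈S-lin U 1ℚ (- (α + β)) Dαβ V∈)
    W∈ : W ∈S U
    W∈ = ∈S-cong {U = U} (λ p → solve 4 (λ W P V a → W := con 1ℚ :* (W :+ (a :* P :+ (a :* a) :* V)) :+ ((:- a) :* P :+ (:- (a :* a)) :* V)) refl (W p) (P p) (V p) α)
                        (∈S-lin₃ U 1ℚ (- α) (- (α * α)) Rα P∈ V∈)

module Parametrisation {m : ℕ} (a : QuadForm m) (z₀ : Vect m) where

  φ : Vect m → Vect m
  φ w = (eval a w · z₀) ⊕ ((- B a z₀ w) · w)

  eval-φ : eval a z₀ ≡ 0ℚ → ∀ w → eval a (φ w) ≡ 0ℚ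
  eval-φ qz₀ w = begin
    eval a (φ w)
      ≡⟨ eval-comb a (eval a w) z₀ (- B a z₀ w) w ⟩
    (Q₀ * Q₀) * eval a z₀ + (Q₀ * (- b)) * b + (- b * - b) * Q₀
      ≡⟨ cong (λ t → (Q₀ * Q₀) * t + (Q₀ * (- b)) * b + (- b * - b) * Q₀) qz₀ ⟩
    (Q₀ * Q₀) * 0ℚ + (Q₀ * (- b)) * b + (- b * - b) * Q₀
      ≡⟨ solve 2 (λ q b → (q :* q) :* con 0ℚ :+ (q :* (:- b)) :* b :+ ((:- b) :* (:- b)) :* q := con 0ℚ) refl Q₀ b ⟩
    0ℚ ∎
    where
    open ≡-Reasoning
    Q₀ = eval a w
    b = B a z₀ w

  φ-⊥ : ∀ {x} → B a x z₀ ≡ 0ℚ → ∀ w → B a x w ≡ 0ℚ → B a x (φ w) ≡ 0ℚ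
  φ-⊥ {x} x⊥z₀ w x⊥w = trans (B-lin₂ a (eval a w) z₀ (- B a z₀ w) w x)
    (trans (cong₂ (λ s t → eval a w * s + (- B a z₀ w) * t) x⊥z₀ x⊥w)
           (solve 2 (λ q b → q :* con 0ℚ :+ b :* con 0ℚ := con 0ℚ) refl (eval a w) (- B a z₀ w)))

  φ-mixed : Vect m → Vect m → Vect m
  φ-mixed w v = (B a w v · z₀) ⊕ (((- B a z₀ w) · v) ⊕ ((- B a z₀ v) · w))

  φ-expand : ∀ w t v → φ (w ⊕ (t · v)) ≈ (φ w ⊕ ((t · φ-mixed w v) ⊕ ((t * t) · φ v)))
  φ-expand w t v p = begin
    eval a (w ⊕ (t · v)) * z₀ p + (- B a z₀ (w ⊕ (t · v))) * (w p + t * v p)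
      ≡⟨ cong₂ (λ E F → E * z₀ p + (- F) * (w p + t * v p)) q-sum b-sum ⟩
    ((eval a w + (t * t) * eval a v) + t * B a w v) * z₀ p + (- (B a z₀ w + t * B a z₀ v)) * (w p + t * v p)
      ≡⟨ solve 9 (λ qw qv bwv bw bv z wp vp t →
           ((qw :+ (t :* t) :* qv) :+ t :* bwv) :* z :+ (:- (bw :+ t :* bv)) :* (wp :+ t :* vp)
           := (qw :* z :+ (:- bw) :* wp) :+ (t :* (bwv :* z :+ ((:- bw) :* vp :+ (:- bv) :* wp)) :+ (t :* t) :* (qv :* z :+ (:- bv) :* vp)))
           refl (eval a w) (eval a v) (B a w v) (B a z₀ w) (B a z₀ v) (z₀ p) (w p) (v p) t ⟩
    (φ w ⊕ ((t · φ-mixed w v) ⊕ ((t * t) · φ v))) p ∎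
    where
    open ≡-Reasoning
    q-sum : eval a (w ⊕ (t · v)) ≡ (eval a w + (t * t) * eval a v) + t * B a w v
    q-sum = trans (eval-add a w (t · v)) (cong₂ (λ s r → (eval a w + s) + r) (eval-scale a t v) (B-scale₂ a t v w))
    b-sum : B a z₀ (w ⊕ (t · v)) ≡ B a z₀ w + t * B a z₀ v
    b-sum = trans (B-add₂ a w (t · v) z₀) (cong (B a z₀ w +_) (B-scale₂ a t v z₀))

  φ-three : ∀ (U : Subspace m) w v (α β γ : ℚ) → α - β ≢ 0ℚ → α - γ ≢ 0ℚ → β - γ ≢ 0ℚ →
    φ (w ⊕ (α · v)) ∈S U → φ (w ⊕ (β · v)) ∈S U → φ (w ⊕ (γ · v)) ∈S U → (φ w ∈S U) × (φ v ∈S U)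
  φ-three U w v α β γ α≢β α≢γ β≢γ Uα Uβ Uγ =
    quadratic-curve U (φ w) (φ-mixed w v) (φ v) α β γ α≢β α≢γ β≢γ (on-curve α Uα) (on-curve β Uβ) (on-curve γ Uγ)
    where
    on-curve : ∀ t → φ (w ⊕ (t · v)) ∈S U → curve (φ w) (φ-mixed w v) (φ v) t ∈S U
    on-curve t = ∈S-cong {U = U} (λ p → sym (φ-expand w t v p))

length-filter-split : ∀ {A : Set} {P : Pred A 0ℓ} (P? : Decidable P) (L : List A) →
                      length L ≡ length (filter P? L) ℕ.+ length (filter (∁? P?) L)
length-filter-split P? [] = refl
length-filter-split P? (x ∷ xs) with P? x
... | yes _ = cong suc (length-filter-split P? xs)
... | no _  = trans (cong suc (length-filter-split P? xs)) (sym (NP.+-suc _ _))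

module Avoidance {I A : Set} (Bad : I → A → Set) (Bad? : ∀ i t → Dec (Bad i t)) where

  AtMostTwo : I → Set
  AtMostTwo i = ∀ {s t u} → s ≢ t → s ≢ u → t ≢ u → Bad i s → Bad i t → Bad i u → ⊥

  at-most-two : ∀ {i} → AtMostTwo i → ∀ {L} → Unique L → All (Bad i) L → length L ≤ 2
  at-most-two two {[]} _ _ = z≤n
  at-most-two two {_ ∷ []} _ _ = s≤s z≤n
  at-most-two two {_ ∷ _ ∷ []} _ _ = s≤s (s≤s z≤n)
  at-most-two two {_ ∷ _ ∷ _ ∷ _} ((s≢t ∷ s≢u ∷ _) ∷ (t≢u ∷ _) ∷ _) (bs ∷ bt ∷ bu ∷ _) =
    ⊥-elim (two s≢t s≢u t≢u bs bt bu)

  avoid : (Is : List I) → All AtMostTwo Is → (L : List A) → Unique L → 2 ℕ.* length Is < length L →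
          ∃ λ t → t ∈ L × All (λ i → ¬ Bad i t) Is
  avoid [] _ (t ∷ _) _ _ = t , here refl , []
  avoid (i ∷ Is) (two ∷ twos) L uniq 2k+2<|L| with avoid Is twos good (UniqueP.filter⁺ (∁? (Bad? i)) uniq) 2k<|good|
    where
    good = filter (∁? (Bad? i)) L
    |L|≤2+|good| : length L ≤ 2 ℕ.+ length good
    |L|≤2+|good| = NP.≤-trans (NP.≤-reflexive (length-filter-split (Bad? i) L))
      (NP.+-monoˡ-≤ (length good) (at-most-two two (UniqueP.filter⁺ (Bad? i) uniq) (all-filter (Bad? i) L)))
    2k<|good| : 2 ℕ.* length Is < length good
    2k<|good| = NP.+-cancelˡ-< 2 (2 ℕ.* length Is) (length good)
      (NP.<-≤-trans (subst (_< length L) (NP.*-suc 2 (length Is)) 2k+2<|L|) |L|≤2+|good|)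
  ... | t , t∈good , ok with ∈-filter⁻ (∁? (Bad? i)) t∈good
  ...   | t∈L , ¬bad = t , t∈L , ¬bad ∷ ok

record HypPairIn {m : ℕ} (a : QuadForm m) (x : Vect m) : Set where
  field
    z₀ y   : Vect m
    q-z₀   : eval a z₀ ≡ 0ℚ
    q-y    : eval a y ≡ 0ℚ
    x⊥z₀   : B a x z₀ ≡ 0ℚ
    x⊥y    : B a x y ≡ 0ℚ
    z₀y≢0  : B a z₀ y ≢ 0ℚ

module _ {m : ℕ} (a : QuadForm m) (x : Vect m) where

  -- Moving a hyperbolic pair (u, v) into x^⊥ along an isotropic w ⊥ u, v
  -- with b(x,w) ≠ 0: the vectors b(x,w)u − b(x,u)w and b(x,w)v − b(x,v)w
  -- are orthogonal to x, isotropic, and pair to b(x,w)²·b(u,v) ≠ 0.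
  lift-pair : ∀ u v w → eval a u ≡ 0ℚ → eval a v ≡ 0ℚ → B a u v ≢ 0ℚ →
              eval a w ≡ 0ℚ → B a u w ≡ 0ℚ → B a v w ≡ 0ℚ → B a x w ≢ 0ℚ → HypPairIn a x
  lift-pair u v w qu qv uv≢0 qw u⊥w v⊥w xw≢0 = record
    { z₀ = along u ; y = along v
    ; q-z₀ = isotropic u qu u⊥w ; q-y = isotropic v qv v⊥w
    ; x⊥z₀ = orthogonal u ; x⊥y = orthogonal v
    ; z₀y≢0 = λ zy≡0 → *-≢0 (s * s) (B a u v) (*-≢0 s s xw≢0 xw≢0) uv≢0 (trans (sym pairing) zy≡0) }
    where
    s = B a x w
    along : Vect m → Vect m
    along p = (s · p) ⊕ ((- B a x p) · w)
    isotropic : ∀ p → eval a p ≡ 0ℚ → B a p w ≡ 0ℚ → eval a (along p) ≡ 0ℚ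
    isotropic p qp p⊥w = begin
      eval a (along p)
        ≡⟨ eval-comb a s p (- B a x p) w ⟩
      (s * s) * eval a p + (s * - B a x p) * B a p w + (- B a x p * - B a x p) * eval a w
        ≡⟨ cong₂ (λ P W → (s * s) * P + (s * - B a x p) * B a p w + (- B a x p * - B a x p) * W) qp qw ⟩
      (s * s) * 0ℚ + (s * - B a x p) * B a p w + (- B a x p * - B a x p) * 0ℚ
        ≡⟨ cong (λ t → (s * s) * 0ℚ + (s * - B a x p) * t + (- B a x p * - B a x p) * 0ℚ) p⊥w ⟩
      (s * s) * 0ℚ + (s * - B a x p) * 0ℚ + (- B a x p * - B a x p) * 0ℚ
        ≡⟨ solve 2 (λ s t → (s :* s) :* con 0ℚ :+ (s :* t) :* con 0ℚ :+ (t :* t) :* con 0ℚ := con 0ℚ) refl s (- B a x p) ⟩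
      0ℚ ∎ where open ≡-Reasoning
    orthogonal : ∀ p → B a x (along p) ≡ 0ℚ
    orthogonal p = trans (B-lin₂ a s p (- B a x p) w x)
      (solve 2 (λ s t → s :* t :+ (:- t) :* s := con 0ℚ) refl s (B a x p))
    pairing : B a (along u) (along v) ≡ (s * s) * B a u v
    pairing = begin
      B a (along u) (along v)
        ≡⟨ B-lin a s u (- B a x u) w (along v) ⟩
      s * B a u (along v) + (- B a x u) * B a w (along v)
        ≡⟨ cong₂ (λ P W → s * P + (- B a x u) * W) (B-lin₂ a s v (- B a x v) w u) (B-lin₂ a s v (- B a x v) w w) ⟩
      s * (s * B a u v + (- B a x v) * B a u w) + (- B a x u) * (s * B a w v + (- B a x v) * B a w w)
        ≡⟨ cong₂ (λ P W → s * (s * B a u v + (- B a x v) * P) + (- B a x u) * (s * W + (- B a x v) * B a w w))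
                 u⊥w (trans (B-sym a w v) v⊥w) ⟩
      s * (s * B a u v + (- B a x v) * 0ℚ) + (- B a x u) * (s * 0ℚ + (- B a x v) * B a w w)
        ≡⟨ cong (λ W → s * (s * B a u v + (- B a x v) * 0ℚ) + (- B a x u) * (s * 0ℚ + (- B a x v) * W)) (B-iso a w qw) ⟩
      s * (s * B a u v + (- B a x v) * 0ℚ) + (- B a x u) * (s * 0ℚ + (- B a x v) * 0ℚ)
        ≡⟨ solve 4 (λ s b p r → s :* (s :* b :+ p :* con 0ℚ) :+ r :* (s :* con 0ℚ :+ p :* con 0ℚ) := (s :* s) :* b) refl s (B a u v) (- B a x v) (- B a x u) ⟩
      (s * s) * B a u v ∎ where open ≡-Reasoning

  -- If
  -- H₁ ⊆ x^⊥ its pair already lies in V; otherwise b(x,w) ≠ 0 for w = u₁ or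
  -- w = v₁, and the pair of H₀ is lifted into V along w.
  module TwoPlanes {h : ℕ} (W : WittDecomp a (suc (suc h))) where
    open WittDecomp W

    u∈H : ∀ i → u i ∈S H i
    u∈H i = (λ { zero → 1ℚ ; (suc _) → 0ℚ }) , λ p →
      solve 2 (λ U V → U := con 1ℚ :* U :+ (con 0ℚ :* V :+ con 0ℚ)) refl (u i p) (v i p)
    v∈H : ∀ i → v i ∈S H i
    v∈H i = (λ { zero → 0ℚ ; (suc _) → 1ℚ }) , λ p →
      solve 2 (λ U V → V := con 0ℚ :* U :+ (con 1ℚ :* V :+ con 0ℚ)) refl (u i p) (v i p)

    H₀⊥H₁ : ∀ {p r} → p ∈S H zero → r ∈S H (suc zero) → B a p r ≡ 0ℚ
    H₀⊥H₁ {p} {r} p∈ r∈ = trans (sym (bil≡B a p r)) (orthHH zero (suc zero) (λ ()) p r p∈ r∈)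

    q-u : ∀ i → eval a (u i) ≡ 0ℚ
    q-u i = proj₁ (hyp i)
    q-v : ∀ i → eval a (v i) ≡ 0ℚ
    q-v i = proj₁ (proj₂ (hyp i))
    uv≢0 : ∀ i → B a (u i) (v i) ≢ 0ℚ
    uv≢0 i uv≡0 = proj₂ (proj₂ (hyp i)) (trans (bil≡B a (u i) (v i)) uv≡0)

    pair : HypPairIn a x
    pair with B a x (u (suc zero)) Q.≟ 0ℚ | B a x (v (suc zero)) Q.≟ 0ℚ
    ... | no xu₁≢0 | _ = lift-pair (u zero) (v zero) (u (suc zero)) (q-u zero) (q-v zero) (uv≢0 zero)
      (q-u (suc zero)) (H₀⊥H₁ (u∈H zero) (u∈H (suc zero))) (H₀⊥H₁ (v∈H zero) (u∈H (suc zero))) xu₁≢0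
    ... | yes _ | no xv₁≢0 = lift-pair (u zero) (v zero) (v (suc zero)) (q-u zero) (q-v zero) (uv≢0 zero)
      (q-v (suc zero)) (H₀⊥H₁ (u∈H zero) (v∈H (suc zero))) (H₀⊥H₁ (v∈H zero) (v∈H (suc zero))) xv₁≢0
    ... | yes xu₁≡0 | yes xv₁≡0 = record
      { z₀ = u (suc zero) ; y = v (suc zero) ; q-z₀ = q-u (suc zero) ; q-y = q-v (suc zero)
      ; x⊥z₀ = xu₁≡0 ; x⊥y = xv₁≡0 ; z₀y≢0 = uv≢0 (suc zero) }

  witt-pair : ∀ {h} → 2 ≤ h → WittDecomp a h → HypPairIn a x
  witt-pair (s≤s (s≤s _)) W = TwoPlanes.pair W

-- The complement C = {z₀, y}^⊥ ∩ x^⊥ of span(z₀, y, x′) in ℚ^m, where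
-- (z₀, y) is a hyperbolic pair in V and x′ ⊥ z₀, y satisfies b(x,x′) ≠ 0.
-- The projection π onto C along span(z₀, y, x′) gives the spanning family
-- π(e_j) of C.
module Complement {m : ℕ} (a : QuadForm m) (x : Vect m) (P : HypPairIn a x)
                  (j₀ : Fin m) (xj₀≢0 : B a x (e j₀) ≢ 0ℚ) where

  open HypPairIn P

  β = B a z₀ y
  ιβ = inv β

  z₀z₀ : B a z₀ z₀ ≡ 0ℚ
  z₀z₀ = B-iso a z₀ q-z₀
  yy : B a y y ≡ 0ℚ
  yy = B-iso a y q-y

  record InC (c : Vect m) : Set where
    field
      ⊥z₀ : B a c z₀ ≡ 0ℚ
      ⊥y  : B a c y ≡ 0ℚ
      x⊥  : B a x c ≡ 0ℚ
  open InC public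

  InC-add : ∀ {c c′} → InC c → InC c′ → InC (c ⊕ c′)
  InC-add {c} {c′} C C′ = record
    { ⊥z₀ = trans (B-add a c c′ z₀) (cong₂ _+_ (⊥z₀ C) (⊥z₀ C′))
    ; ⊥y  = trans (B-add a c c′ y) (cong₂ _+_ (⊥y C) (⊥y C′))
    ; x⊥  = trans (B-add₂ a c c′ x) (cong₂ _+_ (x⊥ C) (x⊥ C′)) }

  kz ky : Vect m → ℚ
  kz v = - (B a v y * ιβ)
  ky v = - (B a v z₀ * ιβ)

  off-pair : Vect m → Vect m
  off-pair v = v ⊕ ((kz v · z₀) ⊕ (ky v · y))

  B-off-pair : ∀ v w → B a (off-pair v) w ≡ B a v w + (kz v * B a z₀ w + ky v * B a y w)
  B-off-pair v w = trans (B-add a v ((kz v · z₀) ⊕ (ky v · y)) w) (cong (B a v w +_) (B-lin a (kz v) z₀ (ky v) y w))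

  off-pair-⊥z₀ : ∀ v → B a (off-pair v) z₀ ≡ 0ℚ
  off-pair-⊥z₀ v = begin
    B a (off-pair v) z₀                                     ≡⟨ B-off-pair v z₀ ⟩
    B a v z₀ + (kz v * B a z₀ z₀ + ky v * B a y z₀)         ≡⟨ cong₂ (λ s t → B a v z₀ + (kz v * s + ky v * t)) z₀z₀ (B-sym a y z₀) ⟩
    B a v z₀ + (kz v * 0ℚ + - (B a v z₀ * ιβ) * β)          ≡⟨ solve 4 (λ b k ι B′ → b :+ (k :* con 0ℚ :+ (:- (b :* ι)) :* B′) := b :* (con 1ℚ :- B′ :* ι)) refl (B a v z₀) (kz v) ιβ β ⟩
    B a v z₀ * (1ℚ - β * ιβ)                               ≡⟨ *[1-cc⁻¹]≡0 (B a v z₀) β z₀y≢0 ⟩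
    0ℚ                                                      ∎ where open ≡-Reasoning

  off-pair-⊥y : ∀ v → B a (off-pair v) y ≡ 0ℚ
  off-pair-⊥y v = begin
    B a (off-pair v) y                                      ≡⟨ B-off-pair v y ⟩
    B a v y + (- (B a v y * ιβ) * β + ky v * B a y y)       ≡⟨ cong (λ t → B a v y + (- (B a v y * ιβ) * β + ky v * t)) yy ⟩
    B a v y + (- (B a v y * ιβ) * β + ky v * 0ℚ)            ≡⟨ solve 4 (λ b k ι B′ → b :+ ((:- (b :* ι)) :* B′ :+ k :* con 0ℚ) := b :* (con 1ℚ :- B′ :* ι)) refl (B a v y) (ky v) ιβ β ⟩
    B a v y * (1ℚ - β * ιβ)                                ≡⟨ *[1-cc⁻¹]≡0 (B a v y) β z₀y≢0 ⟩
    0ℚ                                                      ∎ where open ≡-Reasoning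

  x-off-pair : ∀ v → B a x (off-pair v) ≡ B a x v
  x-off-pair v = trans (B-add₂ a v ((kz v · z₀) ⊕ (ky v · y)) x)
    (trans (cong (B a x v +_) (trans (B-lin₂ a (kz v) z₀ (ky v) y x) (cong₂ (λ s t → kz v * s + ky v * t) x⊥z₀ x⊥y)))
           (solve 3 (λ b k l → b :+ (k :* con 0ℚ :+ l :* con 0ℚ) := b) refl (B a x v) (kz v) (ky v)))

  x′ : Vect m
  x′ = off-pair (e j₀)

  γ = B a x x′
  ιγ = inv γ

  γ≢0 : γ ≢ 0ℚ
  γ≢0 γ≡0 = xj₀≢0 (trans (sym (x-off-pair (e j₀))) γ≡0)

  kx : Vect m → ℚ
  kx v = - (B a x (off-pair v) * ιγ)

  π : Vect m → Vect m
  π v = off-pair v ⊕ (kx v · x′)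

  B-π : ∀ v w → B a (π v) w ≡ B a (off-pair v) w + kx v * B a x′ w
  B-π v w = trans (B-add a (off-pair v) (kx v · x′) w) (cong (B a (off-pair v) w +_) (B-scale a (kx v) x′ w))

  π∈C : ∀ v → InC (π v)
  π∈C v = record
    { ⊥z₀ = trans (B-π v z₀) (trans (cong₂ (λ s t → s + kx v * t) (off-pair-⊥z₀ v) (off-pair-⊥z₀ (e j₀))) (zero-sum (kx v)))
    ; ⊥y  = trans (B-π v y) (trans (cong₂ (λ s t → s + kx v * t) (off-pair-⊥y v) (off-pair-⊥y (e j₀))) (zero-sum (kx v)))
    ; x⊥  = begin
        B a x (π v)                                      ≡⟨ trans (B-add₂ a (off-pair v) (kx v · x′) x) (cong (B a x (off-pair v) +_) (B-scale₂ a (kx v) x′ x)) ⟩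
        B a x (off-pair v) + - (B a x (off-pair v) * ιγ) * γ ≡⟨ solve 3 (λ b ι g → b :+ (:- (b :* ι)) :* g := b :* (con 1ℚ :- g :* ι)) refl (B a x (off-pair v)) ιγ γ ⟩
        B a x (off-pair v) * (1ℚ - γ * ιγ)                ≡⟨ *[1-cc⁻¹]≡0 (B a x (off-pair v)) γ γ≢0 ⟩
        0ℚ                                                 ∎ }
    where
    open ≡-Reasoning
    zero-sum : ∀ k → 0ℚ + k * 0ℚ ≡ 0ℚ
    zero-sum k = solve 1 (λ k → con 0ℚ :+ k :* con 0ℚ := con 0ℚ) refl k

  decomp : ∀ v → v ≈ (π v ⊕ (((- kz v) · z₀) ⊕ (((- ky v) · y) ⊕ ((- kx v) · x′))))
  decomp v p = solve 7 (λ vp a b c z yy xx → vp := ((vp :+ (a :* z :+ b :* yy)) :+ c :* xx) :+ ((:- a) :* z :+ ((:- b) :* yy :+ (:- c) :* xx)))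
    refl (v p) (kz v) (ky v) (kx v) (z₀ p) (y p) (x′ p)

  decomp-V : ∀ v → B a x v ≡ 0ℚ → v ≈ (π v ⊕ (((- kz v) · z₀) ⊕ ((- ky v) · y)))
  decomp-V v x⊥v p = trans (decomp v p)
    (trans (cong (λ t → π v p + (((- kz v) * z₀ p) + (((- ky v) * y p) + (- t) * x′ p))) kx≡0)
           (solve 5 (λ P a z b xx → P :+ (a :* z :+ (b :+ (:- con 0ℚ) :* xx)) := P :+ (a :* z :+ b)) refl (π v p) (- kz v) (z₀ p) ((- ky v) * y p) (x′ p)))
    where
    kx≡0 : kx v ≡ 0ℚ
    kx≡0 = trans (cong (λ t → - (t * ιγ)) (trans (x-off-pair v) x⊥v)) (solve 1 (λ i → :- (con 0ℚ :* i) := con 0ℚ) refl ιγ)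

  pe : Fin m → Vect m
  pe j = π (e j)

  ∑-coefficient : ∀ (c : Vect m) (f : Vect m → ℚ) s → ∑ (λ j → c j * f (e j)) ≡ 0ℚ → ∑ (λ j → c j * - (f (e j) * s)) ≡ 0ℚ
  ∑-coefficient c f s ∑≡0 = begin
    ∑ (λ j → c j * - (f (e j) * s))   ≡⟨ ∑-cong (λ j → solve 3 (λ c b s → c :* (:- (b :* s)) := (:- s) :* (c :* b)) refl (c j) (f (e j)) s) ⟩
    ∑ (λ j → (- s) * (c j * f (e j))) ≡⟨ ∑-* (- s) (λ j → c j * f (e j)) ⟩
    (- s) * ∑ (λ j → c j * f (e j))   ≡⟨ cong ((- s) *_) ∑≡0 ⟩
    (- s) * 0ℚ                        ≡⟨ QP.*-zeroʳ (- s) ⟩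
    0ℚ                                ∎ where open ≡-Reasoning

  -- The π(eⱼ) span C: for c ∈ C, Σⱼ cⱼ π(eⱼ) = c, because the z₀-, y- and
  -- x′-coefficients add up to multiples of b(c,y), b(c,z₀) and b(x,c).
  C-span : ∀ c → InC c → c ≈ comb c pe
  C-span c C p = sym (begin
    comb c pe p
      ≡⟨ comb-coord c pe p ⟩
    ∑ (λ j → c j * pe j p)
      ≡⟨ ∑-cong (λ j → solve 8 (λ cj ej a z b yy k xx → cj :* ((ej :+ (a :* z :+ b :* yy)) :+ k :* xx)
                                := cj :* ej :+ (z :* (cj :* a) :+ (yy :* (cj :* b) :+ xx :* (cj :* k))))
                 refl (c j) (e j p) (kz (e j)) (z₀ p) (ky (e j)) (y p) (kx (e j)) (x′ p)) ⟩
    ∑ (λ j → c j * e j p + (z₀ p * (c j * kz (e j)) + (y p * (c j * ky (e j)) + x′ p * (c j * kx (e j)))))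
      ≡⟨ ∑-expand (λ j → c j * e j p) (λ j → c j * kz (e j)) (λ j → c j * ky (e j)) (λ j → c j * kx (e j)) (z₀ p) (y p) (x′ p) ⟩
    ∑ (λ j → c j * e j p) + (z₀ p * Sz + (y p * Sy + x′ p * Sx))
      ≡⟨ cong₂ (λ s t → s + (z₀ p * t + (y p * Sy + x′ p * Sx))) (∑-e c p) Sz≡0 ⟩
    c p + (z₀ p * 0ℚ + (y p * Sy + x′ p * Sx))
      ≡⟨ cong₂ (λ s t → c p + (z₀ p * 0ℚ + (y p * s + x′ p * t))) Sy≡0 Sx≡0 ⟩
    c p + (z₀ p * 0ℚ + (y p * 0ℚ + x′ p * 0ℚ))
      ≡⟨ solve 4 (λ c z yy xx → c :+ (z :* con 0ℚ :+ (yy :* con 0ℚ :+ xx :* con 0ℚ)) := c) refl (c p) (z₀ p) (y p) (x′ p) ⟩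
    c p ∎)
    where
    open ≡-Reasoning
    Sz = ∑ (λ j → c j * kz (e j))
    Sy = ∑ (λ j → c j * ky (e j))
    Sx = ∑ (λ j → c j * kx (e j))
    Sz≡0 : Sz ≡ 0ℚ
    Sz≡0 = ∑-coefficient c (λ v → B a v y) ιβ (trans (sym (B-coord a c y)) (⊥y C))
    Sy≡0 : Sy ≡ 0ℚ
    Sy≡0 = ∑-coefficient c (λ v → B a v z₀) ιβ (trans (sym (B-coord a c z₀)) (⊥z₀ C))
    Sx≡0 : Sx ≡ 0ℚ
    Sx≡0 = ∑-coefficient c (λ v → B a x (off-pair v)) ιγ
             (trans (∑-cong (λ j → cong (c j *_) (x-off-pair (e j)))) (trans (sym (B-coord₂ a x c)) (x⊥ C)))

  ker-criterion : ∀ k → B a k z₀ ≡ 0ℚ → B a k y ≡ 0ℚ → B a k x′ ≡ 0ℚ → (∀ j → B a k (pe j) ≡ 0ℚ) → Ker a k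
  ker-criterion k k⊥z₀ k⊥y k⊥x′ k⊥C = ker-on-basis a k k⊥e
    where
    k⊥e : ∀ j → B a k (e j) ≡ 0ℚ
    k⊥e j = begin
      B a k (e j)
        ≡⟨ B-cong a {k} {k} (λ _ → refl) (decomp (e j)) ⟩
      B a k (pe j ⊕ (((- kz (e j)) · z₀) ⊕ (((- ky (e j)) · y) ⊕ ((- kx (e j)) · x′))))
        ≡⟨ trans (B-add₂ a (pe j) _ k) (cong (B a k (pe j) +_) (trans (B-add₂ a ((- kz (e j)) · z₀) _ k)
             (cong₂ _+_ (B-scale₂ a (- kz (e j)) z₀ k) (B-lin₂ a (- ky (e j)) y (- kx (e j)) x′ k)))) ⟩
      B a k (pe j) + ((- kz (e j)) * B a k z₀ + ((- ky (e j)) * B a k y + (- kx (e j)) * B a k x′))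
        ≡⟨ cong₂ (λ s t → s + ((- kz (e j)) * t + ((- ky (e j)) * B a k y + (- kx (e j)) * B a k x′))) (k⊥C j) k⊥z₀ ⟩
      0ℚ + ((- kz (e j)) * 0ℚ + ((- ky (e j)) * B a k y + (- kx (e j)) * B a k x′))
        ≡⟨ cong₂ (λ s t → 0ℚ + ((- kz (e j)) * 0ℚ + ((- ky (e j)) * s + (- kx (e j)) * t))) k⊥y k⊥x′ ⟩
      0ℚ + ((- kz (e j)) * 0ℚ + ((- ky (e j)) * 0ℚ + (- kx (e j)) * 0ℚ))
        ≡⟨ solve 3 (λ p q r → con 0ℚ :+ (p :* con 0ℚ :+ (q :* con 0ℚ :+ r :* con 0ℚ)) := con 0ℚ) refl (- kz (e j)) (- ky (e j)) (- kx (e j)) ⟩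
      0ℚ ∎ where open ≡-Reasoning

  -- If b vanishes on C × C, then rank(q) ≤ 4.  Indeed, choose c₁ = π(e_{j₁})
  -- and scalars tᵢ with kᵢ = π(eᵢ) + tᵢ c₁ ⊥ x′ (possible since b(·,x′) is a
  -- single linear condition on C); then every kᵢ lies in ker(q), and
  -- eᵢ ∈ span(z₀, y, x′, c₁) + ker(q) for all i.
  module TotallyIsotropicC {r : ℕ} (rk : Rank a r) (C-null : ∀ i j → B a (pe i) (pe j) ≡ 0ℚ) where

    B-shift : ∀ i t j₁ w → B a (pe i ⊕ (t · pe j₁)) w ≡ B a (pe i) w + t * B a (pe j₁) w
    B-shift i t j₁ w = trans (B-add a (pe i) (t · pe j₁) w) (cong (B a (pe i) w +_) (B-scale a t (pe j₁) w))

    null-shift : ∀ i t j₁ {w} → B a (pe i) w ≡ 0ℚ → B a (pe j₁) w ≡ 0ℚ → B a (pe i ⊕ (t · pe j₁)) w ≡ 0ℚ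
    null-shift i t j₁ {w} i⊥w j₁⊥w = trans (B-shift i t j₁ w)
      (trans (cong₂ (λ s u → s + t * u) i⊥w j₁⊥w) (solve 1 (λ t → con 0ℚ :+ t :* con 0ℚ := con 0ℚ) refl t))

    bound : ∀ j₁ (t : Fin m → ℚ) → (∀ i → B a (pe i ⊕ (t i · pe j₁)) x′ ≡ 0ℚ) → r ≤ 4
    bound j₁ t k⊥x′ = rank-bound a rk g (λ i → coeff i , pe i ⊕ (t i · pe j₁) , ker i , split i)
      where
      g : Fin 4 → Vect m
      g = λ { zero → z₀ ; (suc zero) → y ; (suc (suc zero)) → x′ ; (suc (suc (suc _))) → pe j₁ }
      coeff : Fin m → Fin 4 → ℚ
      coeff i = λ { zero → - kz (e i) ; (suc zero) → - ky (e i) ; (suc (suc zero)) → - kx (e i) ; (suc (suc (suc _))) → - t i }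
      ker : ∀ i → Ker a (pe i ⊕ (t i · pe j₁))
      ker i = ker-criterion (pe i ⊕ (t i · pe j₁)) (null-shift i (t i) j₁ (⊥z₀ (π∈C (e i))) (⊥z₀ (π∈C (e j₁))))
                              (null-shift i (t i) j₁ (⊥y (π∈C (e i))) (⊥y (π∈C (e j₁))))
                              (k⊥x′ i) (λ j → null-shift i (t i) j₁ (C-null i j) (C-null j₁ j))
      split : ∀ i → e i ≈ (comb (coeff i) g ⊕ (pe i ⊕ (t i · pe j₁)))
      split i p = trans (decomp (e i) p)
        (solve 9 (λ P a z b yy c xx t c₁ → P :+ (a :* z :+ (b :* yy :+ c :* xx))
                    := (a :* z :+ (b :* yy :+ (c :* xx :+ ((:- t) :* c₁ :+ con 0ℚ)))) :+ (P :+ t :* c₁))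
           refl (pe i p) (- kz (e i)) (z₀ p) (- ky (e i)) (y p) (- kx (e i)) (x′ p) (t i) (pe j₁ p))

    rank≤4 : r ≤ 4
    rank≤4 with all-or-counterexample (λ j → B a (pe j) x′ ≡ 0ℚ) (λ j → B a (pe j) x′ Q.≟ 0ℚ)
    ... | inj₁ C⊥x′ = bound j₀ (λ _ → 0ℚ) (λ i → null-shift i 0ℚ j₀ (C⊥x′ i) (C⊥x′ j₀))
    ... | inj₂ (j₁ , δ≢0) = bound j₁ t (λ i → trans (B-shift i (t i) j₁ x′)
          (trans (solve 3 (λ b ι d → b :+ (:- (b :* ι)) :* d := b :* (con 1ℚ :- d :* ι)) refl (B a (pe i) x′) (inv δ) δ)
                 (*[1-cc⁻¹]≡0 (B a (pe i) x′) δ δ≢0)))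
      where
      δ = B a (pe j₁) x′
      t : Fin m → ℚ
      t i = - (B a (pe i) x′ * inv δ)

  -- Rank ≥ 5 forces a non-isotropic vector in C: either some π(eⱼ) has
  -- q ≠ 0, or some b(π(eᵢ), π(eⱼ)) ≠ 0 and then q(π(eᵢ) + π(eⱼ)) ≠ 0.
  anisotropic-in-C : ∀ {r} → 5 ≤ r → Rank a r → Σ (Vect m) λ c → InC c × (eval a c ≢ 0ℚ)
  anisotropic-in-C {r} 5≤r rk with all-or-counterexample (λ j → eval a (pe j) ≡ 0ℚ) (λ j → eval a (pe j) Q.≟ 0ℚ)
  ... | inj₂ (j , q≢0) = pe j , π∈C (e j) , q≢0
  ... | inj₁ C-iso with all-or-counterexample (λ i → ∀ j → B a (pe i) (pe j) ≡ 0ℚ) (λ i → FP.all? (λ j → B a (pe i) (pe j) Q.≟ 0ℚ))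
  ...   | inj₁ C-null = ⊥-elim (NP.<-irrefl refl (NP.≤-trans 5≤r (TotallyIsotropicC.rank≤4 rk C-null)))
  ...   | inj₂ (i , not-null) with FP.¬∀⟶∃¬ m _ (λ j → B a (pe i) (pe j) Q.≟ 0ℚ) not-null
  ...     | j , b≢0 = pe i ⊕ pe j , InC-add (π∈C (e i)) (π∈C (e j)) , λ q≡0 → b≢0 (trans (sym q≡b) q≡0)
    where
    q≡b : eval a (pe i ⊕ pe j) ≡ B a (pe i) (pe j)
    q≡b = trans (eval-add a (pe i) (pe j))
      (trans (cong₂ (λ s t → (s + t) + B a (pe i) (pe j)) (C-iso i) (C-iso j)) (QP.+-identityˡ _))

toℚ : ℕ → ℚ
toℚ t = Q.mkℚ (ℤ.+ t) 0 (Coprime.sym (Coprime.1-coprimeTo t))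

toℚ-distinct : ∀ {s t} → s ≢ t → toℚ s - toℚ t ≢ 0ℚ
toℚ-distinct {s} {t} s≢t d≡0 = s≢t (cong ℤ.∣_∣ (proj₁ (QP.mkℚ-injective (begin
  toℚ s                      ≡⟨ solve 2 (λ p q → p := (p :- q) :+ q) refl (toℚ s) (toℚ t) ⟩
  (toℚ s - toℚ t) + toℚ t    ≡⟨ cong (_+ toℚ t) d≡0 ⟩
  0ℚ + toℚ t                 ≡⟨ QP.+-identityˡ (toℚ t) ⟩
  toℚ t                      ∎)))) where open ≡-Reasoning

module Escape {m : ℕ} (a : QuadForm m) (x : Vect m) (P : HypPairIn a x)
              (j₀ : Fin m) (xj₀≢0 : B a x (e j₀) ≢ 0ℚ)
              (c★ : Vect m) (c★∈C : Complement.InC a x P j₀ xj₀≢0 c★) (qc★≢0 : eval a c★ ≢ 0ℚ) where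

  open HypPairIn P
  open Complement a x P j₀ xj₀≢0
  open Parametrisation a z₀

  InV : Vect m → Set
  InV v = B a x v ≡ 0ℚ

  _⊇V : Subspace m → Set
  U ⊇V = ∀ v → InV v → v ∈S U

  -- The vectors y, c★, π(eⱼ), y + π(eⱼ) lie in V, and if φ maps all of them
  -- into U then V ⊆ U: φ(y) = −β·y, φ(c★) = q(c★)·z₀, and
  -- φ(y) + φ(c) − φ(y + c) = β·c for c ∈ C, so z₀, y and C lie in U.
  V⊆U : ∀ U → φ y ∈S U → φ c★ ∈S U → (∀ j → φ (pe j) ∈S U) → (∀ j → φ (y ⊕ (1ℚ · pe j)) ∈S U) → U ⊇V
  V⊆U U φy∈ φc★∈ φC∈ φyC∈ v v∈V =
    ∈S-cong {U = U} (decomp-V v v∈V) (∈S-add U πv∈ (∈S-lin U (- kz v) (- ky v) z₀∈ y∈))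
    where
    y∈ : y ∈S U
    y∈ = divide∈S U (- β) (-ve-≢0 β z₀y≢0) φy∈ (λ p →
      trans (cong (λ q → q * z₀ p + (- β) * y p) q-y) (solve 3 (λ z b yy → con 0ℚ :* z :+ b :* yy := b :* yy) refl (z₀ p) (- β) (y p)))
    z₀∈ : z₀ ∈S U
    z₀∈ = divide∈S U (eval a c★) qc★≢0 φc★∈ (λ p →
      trans (cong (λ b → eval a c★ * z₀ p + (- b) * c★ p) (trans (B-sym a z₀ c★) (⊥z₀ c★∈C)))
            (solve 3 (λ q z c → q :* z :+ (:- con 0ℚ) :* c := q :* z) refl (eval a c★) (z₀ p) (c★ p)))
    pe∈ : ∀ j → pe j ∈S U
    pe∈ j = difference∈S U β z₀y≢0 (∈S-add U φy∈ (φC∈ j)) (φyC∈ j) (λ p → begin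
      (φ y p + φ c p) - φ (y ⊕ (1ℚ · c)) p
        ≡⟨ cong (λ t → (φ y p + φ c p) - t) (φ-expand y 1ℚ c p) ⟩
      (φ y p + φ c p) - (φ y p + (1ℚ * φ-mixed y c p + (1ℚ * 1ℚ) * φ c p))
        ≡⟨ solve 3 (λ Y C M → (Y :+ C) :- (Y :+ (con 1ℚ :* M :+ (con 1ℚ :* con 1ℚ) :* C)) := :- M) refl (φ y p) (φ c p) (φ-mixed y c p) ⟩
      - φ-mixed y c p
        ≡⟨ cong₂ (λ s t → - (s * z₀ p + ((- β) * c p + (- t) * y p))) (trans (B-sym a y c) (⊥y C)) (trans (B-sym a z₀ c) (⊥z₀ C)) ⟩
      - (0ℚ * z₀ p + ((- β) * c p + (- 0ℚ) * y p))
        ≡⟨ solve 4 (λ z b cc yy → :- (con 0ℚ :* z :+ ((:- b) :* cc :+ (:- con 0ℚ) :* yy)) := b :* cc) refl (z₀ p) β (c p) (y p) ⟩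
      β * c p ∎)
      where
      open ≡-Reasoning
      c = pe j
      C = π∈C (e j)
    πv∈ : π v ∈S U
    πv∈ = ∈S-cong {U = U} (C-span (π v) (π∈C v)) (∈S-comb U (π v) pe pe∈)

  escape : ∀ U → ¬ (U ⊇V) → Σ (Vect m) λ w → InV w × ¬ (φ w ∈S U)
  escape U V⊈U with dec∈S U (φ y) | dec∈S U (φ c★)
                  | all-or-counterexample (λ j → φ (pe j) ∈S U) (λ j → dec∈S U (φ (pe j)))
                  | all-or-counterexample (λ j → φ (y ⊕ (1ℚ · pe j)) ∈S U) (λ j → dec∈S U (φ (y ⊕ (1ℚ · pe j))))
  ... | no φy∉ | _ | _ | _ = y , x⊥y , φy∉
  ... | yes _ | no φc★∉ | _ | _ = c★ , x⊥ c★∈C , φc★∉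
  ... | yes _ | yes _ | inj₂ (j , φpe∉) | _ = pe j , x⊥ (π∈C (e j)) , φpe∉
  ... | yes _ | yes _ | inj₁ _ | inj₂ (j , φype∉) = y ⊕ (1ℚ · pe j) , x⊥y+pe , φype∉
    where
    x⊥y+pe : InV (y ⊕ (1ℚ · pe j))
    x⊥y+pe = trans (B-add₂ a y (1ℚ · pe j) x)
      (trans (cong₂ _+_ x⊥y (trans (B-scale₂ a 1ℚ (pe j) x) (cong (1ℚ *_) (x⊥ (π∈C (e j)))))) (QP.*-zeroʳ 1ℚ))
  ... | yes φy∈ | yes φc★∈ | inj₁ φC∈ | inj₁ φyC∈ = ⊥-elim (V⊈U (V⊆U U φy∈ φc★∈ φC∈ φyC∈))

  -- Given w ∈ V with φ(w) outside each of Us, and v ∈ V with φ(v) ∉ U, each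
  -- subspace catches at most two of the φ(w + t v) (by φ-three), so one of
  -- t = 0, …, 2k+2 works for U and all of Us simultaneously.
  extend : ∀ U Us w v → InV w → All (λ U′ → ¬ (φ w ∈S U′)) Us → InV v → ¬ (φ v ∈S U) →
           Σ (Vect m) λ w′ → InV w′ × All (λ U′ → ¬ (φ w′ ∈S U′)) (U ∷ Us)
  extend U Us w v w∈V w-ok v∈V φv∉U = w ⊕ (toℚ t · v) , w′∈V , ok
    where
    Bad : Subspace m → ℕ → Set
    Bad U′ t = φ (w ⊕ (toℚ t · v)) ∈S U′
    open Avoidance Bad (λ U′ t → dec∈S U′ (φ (w ⊕ (toℚ t · v))))
    three-bad : ∀ U′ {s t u} → s ≢ t → s ≢ u → t ≢ u → Bad U′ s → Bad U′ t → Bad U′ u → (φ w ∈S U′) × (φ v ∈S U′)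
    three-bad U′ {s} {t} {u} s≢t s≢u t≢u = φ-three U′ w v (toℚ s) (toℚ t) (toℚ u) (toℚ-distinct s≢t) (toℚ-distinct s≢u) (toℚ-distinct t≢u)
    two : ∀ U′ → ¬ (φ w ∈S U′) ⊎ ¬ (φ v ∈S U′) → AtMostTwo U′
    two U′ (inj₁ φw∉) s≢t s≢u t≢u bs bt bu = φw∉ (proj₁ (three-bad U′ s≢t s≢u t≢u bs bt bu))
    two U′ (inj₂ φv∉) s≢t s≢u t≢u bs bt bu = φv∉ (proj₂ (three-bad U′ s≢t s≢u t≢u bs bt bu))
    N = suc (2 ℕ.* length (U ∷ Us))
    found = avoid (U ∷ Us) (two U (inj₂ φv∉U) ∷ All.map (two _ ∘ inj₁) w-ok) (upTo N) (UniqueP.upTo⁺ N)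
                  (subst (2 ℕ.* length (U ∷ Us) <_) (sym (LP.length-upTo N)) (NP.n<1+n _))
    t = proj₁ found
    ok = proj₂ (proj₂ found)
    w′∈V : InV (w ⊕ (toℚ t · v))
    w′∈V = trans (B-add₂ a w (toℚ t · v) x)
      (trans (cong₂ _+_ w∈V (trans (B-scale₂ a (toℚ t) v x) (cong (toℚ t *_) v∈V))) (cong (0ℚ +_) (QP.*-zeroʳ (toℚ t))))

  escape-all : ∀ Us → All (λ U → ¬ (U ⊇V)) Us → Σ (Vect m) λ w → InV w × All (λ U → ¬ (φ w ∈S U)) Us
  escape-all [] [] = zeroV , B-zero₂ a x , []
  escape-all (U ∷ Us) (V⊈U ∷ V⊈Us) with escape-all Us V⊈Us | escape U V⊈U
  ... | w , w∈V , w-ok | v , v∈V , φv∉U = extend U Us w v w∈V w-ok v∈V φv∉U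

module _ {m : ℕ} (a : QuadForm m) (x : Vect m) where

  perp-line⇒ : ∀ v → Perp a (line x) v → B a x v ≡ 0ℚ
  perp-line⇒ v v⊥ = trans (B-sym a x v) (trans (sym (bil≡B a v x))
    (v⊥ x ((λ _ → 1ℚ) , λ p → solve 1 (λ z → z := con 1ℚ :* z :+ con 0ℚ) refl (x p))))

  ⇒perp-line : ∀ v → B a x v ≡ 0ℚ → Perp a (line x) v
  ⇒perp-line v x⊥v u (c , u≈) = begin
    bil a v u                              ≡⟨ bil≡B a v u ⟩
    B a v u                                ≡⟨ B-cong a {v} {v} (λ _ → refl) u≈ ⟩
    B a v ((c zero · x) ⊕ zeroV)           ≡⟨ B-add₂ a (c zero · x) zeroV v ⟩
    B a v (c zero · x) + B a v zeroV       ≡⟨ cong₂ _+_ (trans (B-scale₂ a (c zero) x v) (cong (c zero *_) (trans (B-sym a v x) x⊥v)))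
                                                        (B-zero₂ a v) ⟩
    c zero * 0ℚ + 0ℚ                       ≡⟨ solve 1 (λ c → c :* con 0ℚ :+ con 0ℚ := con 0ℚ) refl (c zero) ⟩
    0ℚ                                     ∎ where open ≡-Reasoning

  basis-witness : ¬ Ker a x → Σ (Fin m) λ j → B a x (e j) ≢ 0ℚ
  basis-witness x∉K with all-or-counterexample (λ j → B a x (e j) ≡ 0ℚ) (λ j → B a x (e j) Q.≟ 0ℚ)
  ... | inj₁ x⊥e = ⊥-elim (x∉K (ker-on-basis a x x⊥e))
  ... | inj₂ witness = witness

lemma10p2 : (n : ℕ) (q : QuadForm (suc n)) →
    (∃[ h ] (2 ≤ h × WittIndex q h)) →
    (∃[ r ] (5 ≤ r × Rank q r)) →
    (x : Vect (suc n)) → eval q x ≡ 0ℚ → ¬ Ker q x →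
    (Us : List (Subspace (suc n))) →
    All (λ U → Proper U × ¬ (∀ v → Perp q (line x) v → v ∈S U)) Us →
    ∃[ z ] (Perp q (line x) z × eval q z ≡ 0ℚ × All (λ U → ¬ (z ∈S U)) Us)
-- The zero is z = φ(w) for a w ∈ V escaping all the subspaces.
lemma10p2 n q (h , 2≤h , W) (r , 5≤r , rk) x _ x∉K Us hyps =
  let P = witt-pair q x 2≤h W
      open HypPairIn P
      open Parametrisation q z₀
      (j₀ , xj₀≢0) = basis-witness q x x∉K
      (c★ , c★∈C , qc★≢0) = Complement.anisotropic-in-C q x P j₀ xj₀≢0 5≤r rk
      open Escape q x P j₀ xj₀≢0 c★ c★∈C qc★≢0 using (escape-all)
      V⊈Us = All.map (λ (_ , V⊈U) U⊇V → V⊈U (λ v v⊥x → U⊇V v (perp-line⇒ q x v v⊥x))) hyps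
      (w , w∈V , w-escapes) = escape-all Us V⊈Us
  in φ w , ⇒perp-line q x (φ w) (φ-⊥ {x} x⊥z₀ w w∈V) , eval-φ q-z₀ w , w-escapes
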